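{- For every integer $k\ge1$ and every positive integer $n$, \[ ||n||_k\le \frac{k(k+5)}{2}\cdot\left\lceil\frac{\lceil\log_2 n\rceil+1}{k}\right\rceil . \]
   Context: An expression is a formal term built from the symbol $x$ using the binary operations $+$ and $\cdot$ (with parentheses); its size is the number of occurrences of $x$ in it. For an integer $k\ge1$ let $\zeta_k=e^{2\pi i/k}$. For $\alpha\in\mathbb{Z}[\zeta_k]$, $||\alpha||_k$ is the minimum size of an expression which evaluates to $\alpha$ when $x=\zeta_k$. -}

module Defs where

open import Data.Nat as ℕ using (ℕ; zero; suc)
open import Data.Nat.Divisibility using (_∣?_)
open import Data.Nat.DivMod using (_/_)
open import Data.Integer as ℤ using (ℤ; +_)
open import Data.List using (List; []; _∷_; length; foldr; filter; replicate; _++_)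
open import Data.Product using (_×_; _,_; proj₁; proj₂)
open import Data.Bool using (Bool; true; false; if_then_else_)
open import Relation.Nullary.Decidable using (does)
open import Relation.Binary.PropositionalEquality using (_≡_)

data Expr : Set where
  var : Expr
  _⊕_ : Expr → Expr → Expr
  _⊗_ : Expr → Expr → Expr

size : Expr → ℕ
size var       = 1
size (e ⊕ f) = size e ℕ.+ size f
size (e ⊗ f) = size e ℕ.+ size f

-- Integer polynomials as little-endian coefficient lists

Poly : Set
Poly = List ℤ

padd : Poly → Poly → Poly
padd []       q        = q
padd p        []       = p
padd (a ∷ p) (b ∷ q) = (a ℤ.+ b) ∷ padd p q

pscale : ℤ → Poly → Poly
pscale c []      = []
pscale c (a ∷ p) = (c ℤ.* a) ∷ pscale c p

pneg : Poly → Poly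
pneg = pscale (ℤ.- (+ 1))

psub : Poly → Poly → Poly
psub p q = padd p (pneg q)

pmul : Poly → Poly → Poly
pmul []      q = []
pmul (a ∷ p) q = padd (pscale a q) (+ 0 ∷ pmul p q)

pconst : ℤ → Poly
pconst c = c ∷ []

pX : Poly
pX = + 0 ∷ + 1 ∷ []

xpowMinus1 : ℕ → Poly
xpowMinus1 n = padd (replicate n (+ 0) ++ (+ 1 ∷ [])) (pconst (ℤ.- (+ 1)))

isZeroℤ : ℤ → Bool
isZeroℤ (+ zero) = true
isZeroℤ _        = false

normalize : Poly → Poly
normalize []      = []
normalize (a ∷ p) with normalize p
... | []    = if isZeroℤ a then [] else (a ∷ [])
... | q ∷ r = a ∷ q ∷ r

lastCoeff : Poly → ℤ
lastCoeff []          = + 0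
lastCoeff (a ∷ [])    = a
lastCoeff (a ∷ b ∷ p) = lastCoeff (b ∷ p)

-- Long division by a monic polynomial g (given normalized), with fuel.
-- Returns (quotient , remainder).
divModFuel : ℕ → Poly → Poly → Poly × Poly
divModFuel zero    p g = [] , normalize p
divModFuel (suc f) p g with normalize p
... | p' with length p' ℕ.<ᵇ length g
...   | true  = [] , p'
...   | false =
  let c    = lastCoeff p'
      sh   = length p' ℕ.∸ length g
      t    = replicate sh (+ 0) ++ (c ∷ [])
      rest = divModFuel f (psub p' (pmul t g)) g
  in padd t (proj₁ rest) , proj₂ rest

pdivMod : Poly → Poly → Poly × Poly
pdivMod p g = divModFuel (suc (length p)) p (normalize g)

pquot : Poly → Poly → Poly
pquot p g = proj₁ (pdivMod p g)

prem : Poly → Poly → Poly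
prem p g = proj₂ (pdivMod p g)

-- Cyclotomic polynomials, via  x^n - 1 = ∏_{d ∣ n} Φ_d,
-- i.e. Φ_n = (x^n - 1) / ∏_{d ∣ n, d < n} Φ_d  (exact division by a monic polynomial).

cycloTable : ℕ → List (ℕ × Poly)
cycloTable zero    = []
cycloTable (suc n) =
  let prev  = cycloTable n
      divs  = filter (λ dp → proj₁ dp ∣? suc n) prev
      denom = foldr (λ dp acc → pmul (proj₂ dp) acc) (pconst (+ 1)) divs
  in prev ++ ((suc n , normalize (pquot (xpowMinus1 (suc n)) denom)) ∷ [])

lastPoly : List (ℕ × Poly) → Poly
lastPoly []           = pconst (+ 1)
lastPoly (dp ∷ [])    = proj₂ dp
lastPoly (dp ∷ e ∷ l) = lastPoly (e ∷ l)

-- Φ_k (for k ≥ 1)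
cyclotomic : ℕ → Poly
cyclotomic k = lastPoly (cycloTable k)

-- ℤ[ζ_k] ≅ ℤ[x]/(Φ_k).  A polynomial p represents p(ζ_k); two polynomials
-- give the same element of ℤ[ζ_k] iff their difference is divisible by Φ_k.

_≈[_]_ : Poly → ℕ → Poly → Set
p ≈[ k ] q = normalize (prem (psub p q) (cyclotomic k)) ≡ []

evalPoly : Expr → Poly
evalPoly var     = pX
evalPoly (e ⊕ f) = padd (evalPoly e) (evalPoly f)
evalPoly (e ⊗ f) = pmul (evalPoly e) (evalPoly f)

EvaluatesTo : ℕ → Expr → ℤ → Set
EvaluatesTo k e α = evalPoly e ≈[ k ] pconst α

-- ⌈ a / k ⌉ for natural numbers (k ≥ 1; value 0 for k = 0, unused)
ceilDiv : ℕ → ℕ → ℕ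
ceilDiv a zero    = 0
ceilDiv a (suc j) = (a ℕ.+ j) / suc j

{-# OPTIONS --safe #-}
module Submission where

-- Write n in binary and read its at most ⌈log₂ n⌉ + 1 bits from the least significant one while
-- the exponent of ζ runs cyclically down through k, …, 1: if e represents ⌊n/2⌋·ζ^(j−1), then
-- (x + x)·e, plus x^j when n is odd, represents n·ζ^j. A bit read at exponent j costs at most
-- j + 2 occurrences of x, so every k consecutive bits cost at most Σⱼ (j + 2) = k(k+5)/2;
-- starting at exponent k, where ζ^k = 1, the result represents n.
--
-- It suffices to argue modulo x^k − 1, since Φ_k divides it. For the cyclotomic polynomials of
-- the table x^n − 1 = ∏_{d ∣ n} Φ_d this, and the monicity of Φ_k needed to divide by it, follow
-- by strong induction once distinct Φ_e, Φ_i are known to be coprime over ℚ. That comes from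
-- the Bézout identity x^gcd(e,i) − 1 ∈ (x^e − 1, x^i − 1) together with the congruence
-- (x^e − 1)/(x^g − 1) ≡ e/g modulo x^g − 1.

open import Data.Bool using (if_then_else_; T; true; false)
open import Data.Empty using (⊥-elim)
open import Data.Integer as ℤ using (ℤ; +_; -[1+_])
import Data.Integer.Properties as ℤₚ
open import Data.List using (List; []; _∷_; length; replicate; _++_; foldr; filter)
open import Data.List.Properties using (filter-++; filter-accept; filter-reject)
import Data.Maybe
open Data.Maybe using (Maybe; just; nothing)
open import Data.Nat as ℕ using (ℕ; zero; suc; _+_; _*_; _∸_; _≤_; _<_; z≤n; s≤s)
import Data.Nat.Properties as ℕₚ
open import Data.Nat.Divisibility using (_∣_; _∣?_; divides; ∣-refl; ∣-trans; ∣⇒≤)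
open import Data.Nat.DivMod using (_/_; _%_; m≡m%n+[m/n]*n; m%n<n; m≥n⇒m/n>0; m*n/n≡m)
open import Data.Nat.GCD using (gcd; gcd-GCD; gcd[m,n]∣m; gcd[m,n]∣n; gcd[m,n]≢0; module Bézout)
open import Data.Nat.Induction using (<-rec)
open import Data.Nat.Logarithm using (⌈log₂_⌉; ⌈log₂⌉-mono-≤; ⌈log₂2*n⌉≡1+⌈log₂n⌉)
open import Data.Nat.Tactic.RingSolver using () renaming (solve-∀ to ℕ-solve-∀)
open import Data.Product using (Σ; _×_; _,_; proj₁; proj₂; ∃; ∃₂)
open import Data.Sum using (inj₁; inj₂; [_,_]′)
open import Data.Unit using (tt)
open import Function using (id; _∘_)
open import Induction.WellFounded using (WfRec)
open import Relation.Nullary using (¬_; yes; no)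
open import Relation.Binary.Bundles using (Setoid)
open import Relation.Binary.PropositionalEquality
import Relation.Binary.Reasoning.Setoid as SetoidReasoning
open import Algebra.Bundles using (CommutativeRing)
import Algebra.Properties.CommutativeSemigroup as CommSemigroupProperties
open import Tactic.RingSolver using (solve-∀)
open import Tactic.RingSolver.Core.AlmostCommutativeRing using (AlmostCommutativeRing; fromCommutativeRing)

open import Defs

-- The ring of integer polynomials

coeff : Poly → ℕ → ℤ
coeff []      i       = + 0
coeff (a ∷ p) zero    = a
coeff (a ∷ p) (suc i) = coeff p i

-- Coefficient lists are not kept normalized, so polynomials are compared coefficientwise.
infix 4 _≋_
record _≋_ (p q : Poly) : Set where
  constructor coeffwise
  field coeff-≡ : ∀ i → coeff p i ≡ coeff q i
open _≋_ public

≋-refl : ∀ {p} → p ≋ p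
≋-refl = coeffwise λ _ → refl

≋-sym : ∀ {p q} → p ≋ q → q ≋ p
≋-sym e = coeffwise λ i → sym (coeff-≡ e i)

≋-trans : ∀ {p q r} → p ≋ q → q ≋ r → p ≋ r
≋-trans e f = coeffwise λ i → trans (coeff-≡ e i) (coeff-≡ f i)

≋-setoid : Setoid _ _
≋-setoid = record
  { Carrier = Poly ; _≈_ = _≋_
  ; isEquivalence = record { refl = ≋-refl ; sym = ≋-sym ; trans = ≋-trans } }

pshift : Poly → Poly
pshift p = + 0 ∷ p

coeff-padd : ∀ p q i → coeff (padd p q) i ≡ coeff p i ℤ.+ coeff q i
coeff-padd []      q       i       = sym (ℤₚ.+-identityˡ _)
coeff-padd (a ∷ p) []      i       = sym (ℤₚ.+-identityʳ _)
coeff-padd (a ∷ p) (b ∷ q) zero    = refl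
coeff-padd (a ∷ p) (b ∷ q) (suc i) = coeff-padd p q i

coeff-pscale : ∀ a p i → coeff (pscale a p) i ≡ a ℤ.* coeff p i
coeff-pscale a []      i       = sym (ℤₚ.*-zeroʳ a)
coeff-pscale a (b ∷ p) zero    = refl
coeff-pscale a (b ∷ p) (suc i) = coeff-pscale a p i

∷-≋ : ∀ {a b p q} → a ≡ b → p ≋ q → (a ∷ p) ≋ (b ∷ q)
∷-≋ a≡b p≋q = coeffwise λ { zero → a≡b ; (suc i) → coeff-≡ p≋q i }

pshift-cong : ∀ {p q} → p ≋ q → pshift p ≋ pshift q
pshift-cong = ∷-≋ refl

pshift-zero : ∀ {p} → p ≋ [] → pshift p ≋ []
pshift-zero z = coeffwise λ { zero → refl ; (suc i) → coeff-≡ z i }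

tail-≋[] : ∀ {a p} → (a ∷ p) ≋ [] → p ≋ []
tail-≋[] e = coeffwise λ i → coeff-≡ e (suc i)

padd-cong : ∀ {p p′ q q′} → p ≋ p′ → q ≋ q′ → padd p q ≋ padd p′ q′
padd-cong {p} {p′} {q} {q′} e f = coeffwise λ i → begin
  coeff (padd p q) i           ≡⟨ coeff-padd p q i ⟩
  coeff p i ℤ.+ coeff q i      ≡⟨ cong₂ ℤ._+_ (coeff-≡ e i) (coeff-≡ f i) ⟩
  coeff p′ i ℤ.+ coeff q′ i    ≡⟨ coeff-padd p′ q′ i ⟨
  coeff (padd p′ q′) i         ∎
  where open ≡-Reasoning

padd-congˡ : ∀ p {q q′} → q ≋ q′ → padd p q ≋ padd p q′
padd-congˡ p = padd-cong (≋-refl {p})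

padd-congʳ : ∀ q {p p′} → p ≋ p′ → padd p q ≋ padd p′ q
padd-congʳ q e = padd-cong e (≋-refl {q})

pscale-cong : ∀ a {p q} → p ≋ q → pscale a p ≋ pscale a q
pscale-cong a {p} {q} e = coeffwise λ i →
  trans (coeff-pscale a p i) (trans (cong (a ℤ.*_) (coeff-≡ e i)) (sym (coeff-pscale a q i)))

padd-comm : ∀ p q → padd p q ≋ padd q p
padd-comm p q = coeffwise λ i →
  trans (coeff-padd p q i) (trans (ℤₚ.+-comm (coeff p i) _) (sym (coeff-padd q p i)))

padd-assoc : ∀ p q r → padd (padd p q) r ≋ padd p (padd q r)
padd-assoc p q r = coeffwise λ i → begin
  coeff (padd (padd p q) r) i                 ≡⟨ coeff-padd (padd p q) r i ⟩
  coeff (padd p q) i ℤ.+ coeff r i            ≡⟨ cong (ℤ._+ coeff r i) (coeff-padd p q i) ⟩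
  (coeff p i ℤ.+ coeff q i) ℤ.+ coeff r i     ≡⟨ ℤₚ.+-assoc (coeff p i) _ _ ⟩
  coeff p i ℤ.+ (coeff q i ℤ.+ coeff r i)     ≡⟨ cong (λ t → coeff p i ℤ.+ t) (coeff-padd q r i) ⟨
  coeff p i ℤ.+ coeff (padd q r) i            ≡⟨ coeff-padd p (padd q r) i ⟨
  coeff (padd p (padd q r)) i                 ∎
  where open ≡-Reasoning

padd-identityʳ : ∀ p → padd p [] ≋ p
padd-identityʳ p = coeffwise λ i → trans (coeff-padd p [] i) (ℤₚ.+-identityʳ _)

pneg-inverseˡ : ∀ p → padd (pneg p) p ≋ []
pneg-inverseˡ p = coeffwise λ i → begin
  coeff (padd (pneg p) p) i                 ≡⟨ coeff-padd (pneg p) p i ⟩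
  coeff (pneg p) i ℤ.+ coeff p i            ≡⟨ cong (ℤ._+ coeff p i) (coeff-pscale (ℤ.- + 1) p i) ⟩
  ℤ.- + 1 ℤ.* coeff p i ℤ.+ coeff p i       ≡⟨ cong (ℤ._+ coeff p i) (ℤₚ.-1*i≡-i (coeff p i)) ⟩
  ℤ.- coeff p i ℤ.+ coeff p i               ≡⟨ ℤₚ.+-inverseˡ (coeff p i) ⟩
  + 0                                       ∎
  where open ≡-Reasoning

pneg-inverseʳ : ∀ p → padd p (pneg p) ≋ []
pneg-inverseʳ p = ≋-trans (padd-comm p (pneg p)) (pneg-inverseˡ p)

pscale-zeroʳ : ∀ a {p} → p ≋ [] → pscale a p ≋ []
pscale-zeroʳ a {p} z = coeffwise λ i →
  trans (coeff-pscale a p i) (trans (cong (a ℤ.*_) (coeff-≡ z i)) (ℤₚ.*-zeroʳ a))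

pscale-zeroˡ : ∀ p → pscale (+ 0) p ≋ []
pscale-zeroˡ p = coeffwise λ i → trans (coeff-pscale (+ 0) p i) (ℤₚ.*-zeroˡ (coeff p i))

pscale-identityˡ : ∀ p → pscale (+ 1) p ≋ p
pscale-identityˡ p = coeffwise λ i → trans (coeff-pscale (+ 1) p i) (ℤₚ.*-identityˡ _)

pscale-distrib-padd : ∀ a p q → pscale a (padd p q) ≋ padd (pscale a p) (pscale a q)
pscale-distrib-padd a p q = coeffwise λ i → begin
  coeff (pscale a (padd p q)) i                    ≡⟨ coeff-pscale a (padd p q) i ⟩
  a ℤ.* coeff (padd p q) i                         ≡⟨ cong (a ℤ.*_) (coeff-padd p q i) ⟩
  a ℤ.* (coeff p i ℤ.+ coeff q i)                  ≡⟨ ℤₚ.*-distribˡ-+ a (coeff p i) _ ⟩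
  a ℤ.* coeff p i ℤ.+ a ℤ.* coeff q i              ≡⟨ cong₂ ℤ._+_ (coeff-pscale a p i) (coeff-pscale a q i) ⟨
  coeff (pscale a p) i ℤ.+ coeff (pscale a q) i    ≡⟨ coeff-padd (pscale a p) (pscale a q) i ⟨
  coeff (padd (pscale a p) (pscale a q)) i         ∎
  where open ≡-Reasoning

pscale-pscale : ∀ a b p → pscale a (pscale b p) ≋ pscale (a ℤ.* b) p
pscale-pscale a b p = coeffwise λ i → begin
  coeff (pscale a (pscale b p)) i     ≡⟨ coeff-pscale a (pscale b p) i ⟩
  a ℤ.* coeff (pscale b p) i          ≡⟨ cong (a ℤ.*_) (coeff-pscale b p i) ⟩
  a ℤ.* (b ℤ.* coeff p i)             ≡⟨ ℤₚ.*-assoc a b _ ⟨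
  a ℤ.* b ℤ.* coeff p i               ≡⟨ coeff-pscale (a ℤ.* b) p i ⟨
  coeff (pscale (a ℤ.* b) p) i        ∎
  where open ≡-Reasoning

pscale-pshift : ∀ a p → pscale a (pshift p) ≋ pshift (pscale a p)
pscale-pshift a p = ∷-≋ (ℤₚ.*-zeroʳ a) ≋-refl

pmul-zeroˡ : ∀ {p} q → p ≋ [] → pmul p q ≋ []
pmul-zeroˡ {[]}    q z = ≋-refl
pmul-zeroˡ {a ∷ p} q z =
  padd-cong {q′ = []} a·q≋0 (pshift-zero (pmul-zeroˡ q (tail-≋[] z)))
  where
  a·q≋0 : pscale a q ≋ []
  a·q≋0 = subst (λ c → pscale c q ≋ []) (sym (coeff-≡ z 0)) (pscale-zeroˡ q)

pmul-zeroʳ : ∀ p {q} → q ≋ [] → pmul p q ≋ []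
pmul-zeroʳ []      z = ≋-refl
pmul-zeroʳ (a ∷ p) z = padd-cong {q′ = []} (pscale-zeroʳ a z) (pshift-zero (pmul-zeroʳ p z))

pmul-congʳ : ∀ {p p′} q → p ≋ p′ → pmul p q ≋ pmul p′ q
pmul-congʳ {[]}    {[]}     q e = ≋-refl
pmul-congʳ {[]}    {a ∷ p′} q e = ≋-sym (pmul-zeroˡ q (≋-sym e))
pmul-congʳ {a ∷ p} {[]}     q e = pmul-zeroˡ q e
pmul-congʳ {a ∷ p} {b ∷ p′} q e rewrite coeff-≡ e 0 =
  padd-congˡ (pscale b q) (pshift-cong (pmul-congʳ q (tail-≋ e)))
  where
  tail-≋ : (a ∷ p) ≋ (b ∷ p′) → p ≋ p′
  tail-≋ e = coeffwise λ i → coeff-≡ e (suc i)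

pmul-congˡ : ∀ p {q q′} → q ≋ q′ → pmul p q ≋ pmul p q′
pmul-congˡ []      e = ≋-refl
pmul-congˡ (a ∷ p) e = padd-cong (pscale-cong a e) (pshift-cong (pmul-congˡ p e))

pmul-cong : ∀ {p p′ q q′} → p ≋ p′ → q ≋ q′ → pmul p q ≋ pmul p′ q′
pmul-cong {p′ = p′} {q} e f = ≋-trans (pmul-congʳ q e) (pmul-congˡ p′ f)

padd-interchange : ∀ w x y z → padd (padd w x) (padd y z) ≋ padd (padd w y) (padd x z)
padd-interchange w x y z = coeffwise λ i → begin
  coeff (padd (padd w x) (padd y z)) i                     ≡⟨ coeff-padd (padd w x) (padd y z) i ⟩
  coeff (padd w x) i ℤ.+ coeff (padd y z) i                ≡⟨ cong₂ ℤ._+_ (coeff-padd w x i) (coeff-padd y z i) ⟩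
  (coeff w i ℤ.+ coeff x i) ℤ.+ (coeff y i ℤ.+ coeff z i)  ≡⟨ +-interchange (coeff w i) _ _ _ ⟩
  (coeff w i ℤ.+ coeff y i) ℤ.+ (coeff x i ℤ.+ coeff z i)  ≡⟨ cong₂ ℤ._+_ (coeff-padd w y i) (coeff-padd x z i) ⟨
  coeff (padd w y) i ℤ.+ coeff (padd x z) i                ≡⟨ coeff-padd (padd w y) (padd x z) i ⟨
  coeff (padd (padd w y) (padd x z)) i                     ∎
  where
  open ≡-Reasoning
  open CommSemigroupProperties ℤₚ.+-commutativeSemigroup renaming (interchange to +-interchange)

pmul-distribˡ : ∀ p q r → pmul p (padd q r) ≋ padd (pmul p q) (pmul p r)
pmul-distribˡ []      q r = ≋-refl
pmul-distribˡ (a ∷ p) q r = begin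
  padd (pscale a (padd q r)) (pshift (pmul p (padd q r)))
    ≈⟨ padd-cong (pscale-distrib-padd a q r) (pshift-cong (pmul-distribˡ p q r)) ⟩
  padd (padd (pscale a q) (pscale a r)) (padd (pshift (pmul p q)) (pshift (pmul p r)))
    ≈⟨ padd-interchange (pscale a q) (pscale a r) (pshift (pmul p q)) (pshift (pmul p r)) ⟩
  padd (pmul (a ∷ p) q) (pmul (a ∷ p) r)
    ∎
  where open SetoidReasoning ≋-setoid

pmul-pshiftʳ : ∀ p q → pmul p (pshift q) ≋ pshift (pmul p q)
pmul-pshiftʳ []      q = ≋-sym (pshift-zero ≋-refl)
pmul-pshiftʳ (a ∷ p) q = padd-cong (pscale-pshift a q) (pshift-cong (pmul-pshiftʳ p q))

pmul-pshiftˡ : ∀ p q → pmul (pshift p) q ≋ pshift (pmul p q)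
pmul-pshiftˡ p q = padd-cong (pscale-zeroˡ q) ≋-refl

pmul-pscaleˡ : ∀ a p q → pmul (pscale a p) q ≋ pscale a (pmul p q)
pmul-pscaleˡ a []      q = ≋-refl
pmul-pscaleˡ a (b ∷ p) q = begin
  padd (pscale (a ℤ.* b) q) (pshift (pmul (pscale a p) q))
    ≈⟨ padd-cong (≋-sym (pscale-pscale a b q)) (pshift-cong (pmul-pscaleˡ a p q)) ⟩
  padd (pscale a (pscale b q)) (pshift (pscale a (pmul p q)))
    ≈⟨ padd-congˡ (pscale a (pscale b q)) (pscale-pshift a (pmul p q)) ⟨
  padd (pscale a (pscale b q)) (pscale a (pshift (pmul p q)))
    ≈⟨ pscale-distrib-padd a (pscale b q) (pshift (pmul p q)) ⟨
  pscale a (pmul (b ∷ p) q)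
    ∎
  where open SetoidReasoning ≋-setoid

pmul-singletonʳ : ∀ a q → pmul q (a ∷ []) ≋ pscale a q
pmul-singletonʳ a []      = ≋-refl
pmul-singletonʳ a (b ∷ q) = begin
  padd (b ℤ.* a ∷ []) (pshift (pmul q (a ∷ [])))
    ≈⟨ padd-cong (∷-≋ (ℤₚ.*-comm b a) (≋-refl {[]})) (pshift-cong (pmul-singletonʳ a q)) ⟩
  padd (a ℤ.* b ∷ []) (pshift (pscale a q))
    ≈⟨ ∷-≋ (ℤₚ.+-identityʳ _) ≋-refl ⟩
  pscale a (b ∷ q)
    ∎
  where open SetoidReasoning ≋-setoid

pmul-comm : ∀ p q → pmul p q ≋ pmul q p
pmul-comm []      q = ≋-sym (pmul-zeroʳ q ≋-refl)
pmul-comm (a ∷ p) q = begin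
  padd (pscale a q) (pshift (pmul p q))       ≈⟨ padd-cong (≋-sym (pmul-singletonʳ a q)) (pshift-cong (pmul-comm p q)) ⟩
  padd (pmul q (a ∷ [])) (pshift (pmul q p))  ≈⟨ padd-congˡ (pmul q (a ∷ [])) (pmul-pshiftʳ q p) ⟨
  padd (pmul q (a ∷ [])) (pmul q (pshift p))  ≈⟨ pmul-distribˡ q (a ∷ []) (pshift p) ⟨
  pmul q (padd (a ∷ []) (pshift p))           ≈⟨ pmul-congˡ q (∷-≋ (ℤₚ.+-identityʳ a) ≋-refl) ⟩
  pmul q (a ∷ p)                              ∎
  where open SetoidReasoning ≋-setoid

pmul-distribʳ : ∀ p q r → pmul (padd q r) p ≋ padd (pmul q p) (pmul r p)
pmul-distribʳ p q r = begin
  pmul (padd q r) p              ≈⟨ pmul-comm (padd q r) p ⟩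
  pmul p (padd q r)              ≈⟨ pmul-distribˡ p q r ⟩
  padd (pmul p q) (pmul p r)     ≈⟨ padd-cong (pmul-comm p q) (pmul-comm p r) ⟩
  padd (pmul q p) (pmul r p)     ∎
  where open SetoidReasoning ≋-setoid

pmul-assoc : ∀ p q r → pmul (pmul p q) r ≋ pmul p (pmul q r)
pmul-assoc []      q r = ≋-refl
pmul-assoc (a ∷ p) q r = begin
  pmul (padd (pscale a q) (pshift (pmul p q))) r            ≈⟨ pmul-distribʳ r (pscale a q) (pshift (pmul p q)) ⟩
  padd (pmul (pscale a q) r) (pmul (pshift (pmul p q)) r)  ≈⟨ padd-cong (pmul-pscaleˡ a q r) (pmul-pshiftˡ (pmul p q) r) ⟩
  padd (pscale a (pmul q r)) (pshift (pmul (pmul p q) r))  ≈⟨ padd-congˡ (pscale a (pmul q r)) (pshift-cong (pmul-assoc p q r)) ⟩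
  padd (pscale a (pmul q r)) (pshift (pmul p (pmul q r)))  ∎
  where open SetoidReasoning ≋-setoid

pmul-identityˡ : ∀ p → pmul (pconst (+ 1)) p ≋ p
pmul-identityˡ p = ≋-trans (pmul-comm (pconst (+ 1)) p) (≋-trans (pmul-singletonʳ (+ 1) p) (pscale-identityˡ p))

Poly-commutativeRing : CommutativeRing _ _
Poly-commutativeRing = record
  { Carrier = Poly ; _≈_ = _≋_ ; _+_ = padd ; _*_ = pmul ; -_ = pneg ; 0# = [] ; 1# = pconst (+ 1)
  ; isCommutativeRing = record
    { isRing = record
      { +-isAbelianGroup = record
        { isGroup = record
          { isMonoid = record
            { isSemigroup = record
              { isMagma = record { isEquivalence = Setoid.isEquivalence ≋-setoid ; ∙-cong = padd-cong }
              ; assoc = padd-assoc }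
            ; identity = (λ _ → ≋-refl) , padd-identityʳ }
          ; inverse = pneg-inverseˡ , pneg-inverseʳ
          ; ⁻¹-cong = pscale-cong (ℤ.- + 1) }
        ; comm = padd-comm }
      ; *-cong = pmul-cong
      ; *-assoc = pmul-assoc
      ; *-identity = pmul-identityˡ , λ p → ≋-trans (pmul-comm p _) (pmul-identityˡ p)
      ; distrib = pmul-distribˡ , pmul-distribʳ }
    ; *-comm = pmul-comm } }

-- Lets the solver discard zero coefficients.
[]≋? : (p : Poly) → Maybe ([] ≋ p)
[]≋? []           = just ≋-refl
[]≋? (+ zero ∷ p) = Data.Maybe.map (λ z → ≋-sym (pshift-zero (≋-sym z))) ([]≋? p)
[]≋? _            = nothing

Poly-ring : AlmostCommutativeRing _ _
Poly-ring = fromCommutativeRing Poly-commutativeRing []≋?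

-- Degree bounds and monic polynomials

record DegreeBelow (n : ℕ) (p : Poly) : Set where
  constructor degreeBelow
  field vanishes : ∀ i → n ≤ i → coeff p i ≡ + 0
open DegreeBelow public

degreeBelow-length : ∀ p → DegreeBelow (length p) p
degreeBelow-length p = degreeBelow (beyond p)
  where
  beyond : ∀ p i → length p ≤ i → coeff p i ≡ + 0
  beyond []      i       _         = refl
  beyond (a ∷ p) (suc i) (s≤s l≤i) = beyond p i l≤i

DegreeBelow-resp-≋ : ∀ {n p q} → p ≋ q → DegreeBelow n q → DegreeBelow n p
DegreeBelow-resp-≋ e deg = degreeBelow λ i n≤i → trans (coeff-≡ e i) (vanishes deg i n≤i)

DegreeBelow-mono : ∀ {m n p} → m ≤ n → DegreeBelow m p → DegreeBelow n p
DegreeBelow-mono m≤n deg = degreeBelow λ i n≤i → vanishes deg i (ℕₚ.≤-trans m≤n n≤i)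

DegreeBelow-lower : ∀ {n p} → DegreeBelow (suc n) p → coeff p n ≡ + 0 → DegreeBelow n p
DegreeBelow-lower {n} {p} deg top = degreeBelow below
  where
  below : ∀ i → n ≤ i → coeff p i ≡ + 0
  below i n≤i with ℕₚ.m≤n⇒m<n∨m≡n n≤i
  ... | inj₁ n<i  = vanishes deg i n<i
  ... | inj₂ refl = top

DegreeBelow-tail : ∀ {n a p} → DegreeBelow (suc n) (a ∷ p) → DegreeBelow n p
DegreeBelow-tail deg = degreeBelow λ i n≤i → vanishes deg (suc i) (s≤s n≤i)

DegreeBelow-zero : ∀ {p} → DegreeBelow 0 p → p ≋ []
DegreeBelow-zero deg = coeffwise λ i → vanishes deg i z≤n

zero-DegreeBelow : ∀ {n p} → p ≋ [] → DegreeBelow n p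
zero-DegreeBelow z = degreeBelow λ i _ → coeff-≡ z i

record Monic (d : ℕ) (g : Poly) : Set where
  constructor monic
  field
    leading : coeff g d ≡ + 1
    degree< : DegreeBelow (suc d) g

1≢0 : + 1 ≢ + 0
1≢0 ()

Monic-resp-≋ : ∀ {d f g} → f ≋ g → Monic d g → Monic d f
Monic-resp-≋ e (monic lead deg) = monic (trans (coeff-≡ e _) lead) (DegreeBelow-resp-≋ e deg)

coeff-pmul-∷ : ∀ a s f i → coeff (pmul (a ∷ s) f) i ≡ a ℤ.* coeff f i ℤ.+ coeff (pshift (pmul s f)) i
coeff-pmul-∷ a s f i = trans (coeff-padd (pscale a f) _ i) (cong (ℤ._+ _) (coeff-pscale a f i))

coeff-pmul-top : ∀ {d f} → Monic d f → ∀ s j → DegreeBelow (suc j) s →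
                 coeff (pmul s f) (d + j) ≡ coeff s j
coeff-pmul-top _ [] j _ = refl
coeff-pmul-top {d} {f} (monic lead _) (a ∷ s) zero deg = begin
  coeff (pmul (a ∷ s) f) (d + 0)                              ≡⟨ coeff-pmul-∷ a s f (d + 0) ⟩
  a ℤ.* coeff f (d + 0) ℤ.+ coeff (pshift (pmul s f)) (d + 0)
                                                              ≡⟨ cong₂ (λ i j → a ℤ.* coeff f i ℤ.+ j) (ℕₚ.+-identityʳ d) s·f≈0 ⟩
  a ℤ.* coeff f d ℤ.+ + 0                                     ≡⟨ cong (λ c → a ℤ.* c ℤ.+ + 0) lead ⟩
  a ℤ.* + 1 ℤ.+ + 0                                           ≡⟨ trans (ℤₚ.+-identityʳ _) (ℤₚ.*-identityʳ a) ⟩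
  a                                                           ∎
  where
  open ≡-Reasoning
  s·f≈0 : coeff (pshift (pmul s f)) (d + 0) ≡ + 0
  s·f≈0 = coeff-≡ (pshift-zero (pmul-zeroˡ f (DegreeBelow-zero (DegreeBelow-tail deg)))) (d + 0)
coeff-pmul-top {d} {f} mf@(monic _ deg-f) (a ∷ s) (suc j) deg = begin
  coeff (pmul (a ∷ s) f) (d + suc j)                                 ≡⟨ coeff-pmul-∷ a s f (d + suc j) ⟩
  a ℤ.* coeff f (d + suc j) ℤ.+ coeff (pshift (pmul s f)) (d + suc j)
                                                                      ≡⟨ cong₂ ℤ._+_ a·0 (cong (coeff (pshift (pmul s f))) (ℕₚ.+-suc d j)) ⟩
  + 0 ℤ.+ coeff (pmul s f) (d + j)                                    ≡⟨ ℤₚ.+-identityˡ _ ⟩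
  coeff (pmul s f) (d + j)                                            ≡⟨ coeff-pmul-top mf s j (DegreeBelow-tail deg) ⟩
  coeff s j                                                           ∎
  where
  open ≡-Reasoning
  a·0 : a ℤ.* coeff f (d + suc j) ≡ + 0
  a·0 = trans (cong (a ℤ.*_) (vanishes deg-f _ (subst (suc d ≤_) (sym (ℕₚ.+-suc d j)) (s≤s (ℕₚ.m≤m+n d j))))) (ℤₚ.*-zeroʳ a)

DegreeBelow-pmul : ∀ {m d s f} → DegreeBelow m s → DegreeBelow (suc d) f → DegreeBelow (m + d) (pmul s f)
DegreeBelow-pmul {zero} {s = s} {f} deg-s _ = zero-DegreeBelow (pmul-zeroˡ f (DegreeBelow-zero deg-s))
DegreeBelow-pmul {suc m} {s = []} _ _ = degreeBelow λ _ _ → refl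
DegreeBelow-pmul {suc m} {d} {a ∷ s} {f} deg-s deg-f = degreeBelow λ i m+d≤i →
  trans (coeff-pmul-∷ a s f i) (cong₂ ℤ._+_ (a·0 i m+d≤i) (shifted i m+d≤i))
  where
  a·0 : ∀ i → suc m + d ≤ i → a ℤ.* coeff f i ≡ + 0
  a·0 i m+d≤i = trans (cong (a ℤ.*_) (vanishes deg-f i (ℕₚ.≤-trans (s≤s (ℕₚ.m≤n+m d m)) m+d≤i))) (ℤₚ.*-zeroʳ a)
  shifted : ∀ i → suc m + d ≤ i → coeff (pshift (pmul s f)) i ≡ + 0
  shifted (suc i) (s≤s m+d≤i) = vanishes (DegreeBelow-pmul (DegreeBelow-tail deg-s) deg-f) i m+d≤i

DegreeBelow-of-pmul-monic : ∀ {d f} → Monic d f → ∀ {m s} → DegreeBelow (d + m) (pmul s f) → DegreeBelow m s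
DegreeBelow-of-pmul-monic {d} mf {m} {s} deg-sf = descend (length s) (degreeBelow-length s)
  where
  descend : ∀ M → DegreeBelow M s → DegreeBelow m s
  descend zero    deg = DegreeBelow-mono z≤n deg
  descend (suc j) deg with m ℕ.≤? j
  ... | no  m≰j = DegreeBelow-mono (ℕₚ.≰⇒> m≰j) deg
  ... | yes m≤j = descend j (DegreeBelow-lower deg
                    (trans (sym (coeff-pmul-top mf s j deg)) (vanishes deg-sf (d + j) (ℕₚ.+-monoʳ-≤ d m≤j))))

pmul-cancelʳ-monic : ∀ {d f} → Monic d f → ∀ a b → pmul a f ≋ pmul b f → a ≋ b
pmul-cancelʳ-monic {d} {f} mf a b e = begin
  a                      ≈⟨ split a b ⟩
  padd (psub a b) b      ≈⟨ padd-congʳ b (DegreeBelow-zero (DegreeBelow-of-pmul-monic mf {s = psub a b} deg)) ⟩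
  b                      ∎
  where
  open SetoidReasoning ≋-setoid
  split : ∀ a b → a ≋ padd (psub a b) b
  split = solve-∀ Poly-ring
  distrib : ∀ a b f → pmul (psub a b) f ≋ psub (pmul a f) (pmul b f)
  distrib = solve-∀ Poly-ring
  [a-b]f≋0 : pmul (psub a b) f ≋ []
  [a-b]f≋0 = ≋-trans (distrib a b f) (≋-trans (padd-congʳ (pneg (pmul b f)) e) (pneg-inverseʳ (pmul b f)))
  deg : DegreeBelow (d + 0) (pmul (psub a b) f)
  deg = zero-DegreeBelow [a-b]f≋0

Monic-pmul : ∀ {d e f s} → Monic d f → Monic e s → Monic (e + d) (pmul s f)
Monic-pmul {d} {e} {f} {s} mf (monic lead deg) = monic
  (trans (cong (coeff (pmul s f)) (ℕₚ.+-comm e d)) (trans (coeff-pmul-top mf s e deg) lead))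
  (DegreeBelow-pmul deg (Monic.degree< mf))

Monic-quotient : ∀ {d k f g} s → Monic d f → Monic k g → pmul s f ≋ g → Monic (k ∸ d) s
Monic-quotient {d} {k} {f} {g} s mf (monic lead deg) sf≋g with d ℕ.≤? k
... | yes d≤k = monic leading deg-s
  where
  d+[k∸d]≡k : d + (k ∸ d) ≡ k
  d+[k∸d]≡k = ℕₚ.m+[n∸m]≡n d≤k
  deg-s : DegreeBelow (suc (k ∸ d)) s
  deg-s = DegreeBelow-of-pmul-monic mf (DegreeBelow-mono
    (ℕₚ.≤-reflexive (trans (cong suc (sym d+[k∸d]≡k)) (sym (ℕₚ.+-suc d (k ∸ d)))))
    (DegreeBelow-resp-≋ sf≋g deg))
  leading : coeff s (k ∸ d) ≡ + 1
  leading = begin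
    coeff s (k ∸ d)                ≡⟨ coeff-pmul-top mf s (k ∸ d) deg-s ⟨
    coeff (pmul s f) (d + (k ∸ d)) ≡⟨ coeff-≡ sf≋g _ ⟩
    coeff g (d + (k ∸ d))          ≡⟨ cong (coeff g) d+[k∸d]≡k ⟩
    coeff g k                      ≡⟨ lead ⟩
    + 1                            ∎
    where open ≡-Reasoning
... | no d≰k = ⊥-elim (1≢0 (trans (sym lead) (trans (sym (coeff-≡ sf≋g k)) (coeff-≡ sf≋0 k))))
  where
  k<d+0 : suc k ≤ d + 0
  k<d+0 = ℕₚ.≤-trans (ℕₚ.≰⇒> d≰k) (ℕₚ.≤-reflexive (sym (ℕₚ.+-identityʳ d)))
  sf≋0 : pmul s f ≋ []
  sf≋0 = pmul-zeroˡ f (DegreeBelow-zero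
    (DegreeBelow-of-pmul-monic mf {s = s} (DegreeBelow-mono k<d+0 (DegreeBelow-resp-≋ sf≋g deg))))

-- Division by a monic polynomial

normalize-≋ : ∀ p → normalize p ≋ p
normalize-≋ []      = ≋-refl
normalize-≋ (a ∷ p) with normalize p | normalize-≋ p
... | []    | e = ≋-trans (singleton a) (∷-≋ refl e)
  where
  singleton : ∀ a → (if isZeroℤ a then [] else (a ∷ [])) ≋ (a ∷ [])
  singleton (+ zero)  = ≋-sym (pshift-zero ≋-refl)
  singleton (+ suc _) = ≋-refl
  singleton -[1+ _ ]  = ≋-refl
... | q ∷ r | e = ∷-≋ refl e

normalize-leading≢0 : ∀ p j → length (normalize p) ≡ suc j → coeff (normalize p) j ≢ + 0
normalize-leading≢0 []      j ()
normalize-leading≢0 (a ∷ p) j with normalize p | normalize-leading≢0 p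
... | []    | _  = singleton a j
  where
  singleton : ∀ a j → length (if isZeroℤ a then [] else (a ∷ [])) ≡ suc j →
              coeff (if isZeroℤ a then [] else (a ∷ [])) j ≢ + 0
  singleton (+ suc _) zero _ ()
  singleton -[1+ _ ]  zero _ ()
... | q ∷ r | ih = λ { refl → ih (length r) refl }

length-normalize : ∀ {n} p → DegreeBelow n p → length (normalize p) ≤ n
length-normalize {n} p deg with length (normalize p) in eq
... | zero  = z≤n
... | suc j with n ℕ.≤? j
...   | no  n≰j = ℕₚ.≰⇒> n≰j
...   | yes n≤j = ⊥-elim (normalize-leading≢0 p j eq
                    (trans (coeff-≡ (normalize-≋ p) j) (vanishes deg j n≤j)))

normalize-zero : ∀ {p} → p ≋ [] → normalize p ≡ []
normalize-zero {p} z with normalize p | length-normalize {0} p (zero-DegreeBelow z)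
... | [] | _ = refl

coeff≢0⇒<length : ∀ p {i} → coeff p i ≢ + 0 → i < length p
coeff≢0⇒<length p {i} c≢0 with i ℕ.<? length p
... | yes i<l = i<l
... | no  i≮l = ⊥-elim (c≢0 (vanishes (degreeBelow-length p) i (ℕₚ.≮⇒≥ i≮l)))

Monic-normalize : ∀ {d g} → Monic d g → Monic d (normalize g) × length (normalize g) ≡ suc d
Monic-normalize {d} {g} mg@(monic lead deg) = mg′ , ℕₚ.≤-antisym
  (length-normalize g deg)
  (coeff≢0⇒<length (normalize g) (λ c≡0 → 1≢0 (trans (sym (Monic.leading mg′)) c≡0)))
  where
  mg′ = Monic-resp-≋ (normalize-≋ g) mg

lastCoeff-coeff : ∀ p → lastCoeff p ≡ coeff p (length p ∸ 1)
lastCoeff-coeff []          = refl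
lastCoeff-coeff (a ∷ [])    = refl
lastCoeff-coeff (a ∷ b ∷ p) = lastCoeff-coeff (b ∷ p)

monomial : ℕ → ℤ → Poly
monomial s c = replicate s (+ 0) ++ (c ∷ [])

coeff-monomial : ∀ s c → coeff (monomial s c) s ≡ c
coeff-monomial zero    c = refl
coeff-monomial (suc s) c = coeff-monomial s c

monomial-degreeBelow : ∀ s c → DegreeBelow (suc s) (monomial s c)
monomial-degreeBelow zero    c = degreeBelow λ { (suc i) _ → refl }
monomial-degreeBelow (suc s) c = degreeBelow λ { (suc i) (s≤s s<i) → vanishes (monomial-degreeBelow s c) i s<i }

coeff-psub : ∀ p q i → coeff (psub p q) i ≡ coeff p i ℤ.- coeff q i
coeff-psub p q i = trans (coeff-padd p (pneg q) i)
  (cong (λ t → coeff p i ℤ.+ t) (trans (coeff-pscale (ℤ.- + 1) q i) (ℤₚ.-1*i≡-i (coeff q i))))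

eliminate-leading : ∀ {d g} → Monic d g → ∀ s c p → coeff p (d + s) ≡ c → DegreeBelow (suc (d + s)) p →
                    DegreeBelow (d + s) (psub p (pmul (monomial s c) g))
eliminate-leading {d} {g} mg s c p lead deg = degreeBelow below
  where
  t·g = pmul (monomial s c) g
  deg-t·g : DegreeBelow (suc s + d) t·g
  deg-t·g = DegreeBelow-pmul (monomial-degreeBelow s c) (Monic.degree< mg)
  below : ∀ i → d + s ≤ i → coeff (psub p t·g) i ≡ + 0
  below i d+s≤i with ℕₚ.m≤n⇒m<n∨m≡n d+s≤i
  ... | inj₁ d+s<i = trans (coeff-psub p t·g i) (cong₂ ℤ._-_ (vanishes deg i d+s<i)
          (vanishes deg-t·g i (subst (_≤ i) (cong suc (ℕₚ.+-comm d s)) d+s<i)))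
  ... | inj₂ refl  = trans (coeff-psub p t·g (d + s)) (trans
          (cong₂ ℤ._-_ lead (trans (coeff-pmul-top mg (monomial s c) s (monomial-degreeBelow s c)) (coeff-monomial s c)))
          (ℤₚ.+-inverseʳ c))

DivisionOf : ℕ → Poly → Poly → Poly × Poly → Set
DivisionOf d p g qr = p ≋ padd (pmul (proj₁ qr) g) (proj₂ qr) × DegreeBelow d (proj₂ qr)

divModFuel-division : ∀ {d g} → Monic d g → length g ≡ suc d →
                      ∀ f p → length (normalize p) ≤ f + d → DivisionOf d p g (divModFuel f p g)
divModFuel-division mg lg zero p len≤d =
  ≋-sym (normalize-≋ p) , DegreeBelow-mono len≤d (degreeBelow-length (normalize p))
divModFuel-division {d} {g} mg lg (suc f) p len≤ with normalize p | normalize-≋ p | len≤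
... | p′ | p′≋p | len-p′≤ with length p′ ℕ.<ᵇ length g in lt?
...   | true  = ≋-sym p′≋p , DegreeBelow-mono len-p′≤d (degreeBelow-length p′)
  where
  len-p′≤d : length p′ ≤ d
  len-p′≤d = ℕₚ.≤-pred (subst (length p′ <_) lg (ℕₚ.<ᵇ⇒< _ _ (subst T (sym lt?) tt)))
...   | false = ≋-trans (≋-sym p′≋p) (reassemble (proj₁ rest-division)) , proj₂ rest-division
  where
  n = length p′
  s = n ∸ length g
  t = monomial s (lastCoeff p′)
  rest = divModFuel f (psub p′ (pmul t g)) g
  d<n : d < n
  d<n = subst (_≤ n) lg (ℕₚ.≮⇒≥ λ n<g → subst T lt? (ℕₚ.<⇒<ᵇ n<g))
  n≡ : n ≡ suc (d + s)
  n≡ = trans (sym (ℕₚ.m+[n∸m]≡n d<n)) (cong (λ l → suc (d + (n ∸ l))) (sym lg))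
  lead : coeff p′ (d + s) ≡ lastCoeff p′
  lead = sym (trans (lastCoeff-coeff p′) (cong (λ l → coeff p′ (l ∸ 1)) n≡))
  rest-division = divModFuel-division mg lg f (psub p′ (pmul t g)) (ℕₚ.≤-trans
    (length-normalize _ (eliminate-leading mg s (lastCoeff p′) p′ lead
      (subst (λ l → DegreeBelow l p′) n≡ (degreeBelow-length p′))))
    (ℕₚ.≤-pred (subst (_≤ suc f + d) n≡ len-p′≤)))
  reassemble : ∀ {q r} → psub p′ (pmul t g) ≋ padd (pmul q g) r → p′ ≋ padd (pmul (padd t q) g) r
  reassemble {q} {r} e = begin
    p′                                          ≈⟨ split p′ (pmul t g) ⟩
    padd (psub p′ (pmul t g)) (pmul t g)        ≈⟨ padd-congʳ (pmul t g) e ⟩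
    padd (padd (pmul q g) r) (pmul t g)         ≈⟨ regroup q g r t ⟩
    padd (pmul (padd t q) g) r                  ∎
    where
    open SetoidReasoning ≋-setoid
    split : ∀ a b → a ≋ padd (psub a b) b
    split = solve-∀ Poly-ring
    regroup : ∀ q g r t → padd (padd (pmul q g) r) (pmul t g) ≋ padd (pmul (padd t q) g) r
    regroup = solve-∀ Poly-ring

pdivMod-division : ∀ {d g} → Monic d g → ∀ p → DivisionOf d p g (pdivMod p g)
pdivMod-division {d} {g} mg p =
  ≋-trans (proj₁ division) (padd-congʳ (prem p g) (pmul-congˡ (pquot p g) (normalize-≋ g))) , proj₂ division
  where
  division = divModFuel-division (proj₁ (Monic-normalize mg)) (proj₂ (Monic-normalize mg)) (suc (length p)) p
    (ℕₚ.≤-trans (length-normalize p (degreeBelow-length p)) (ℕₚ.m≤n⇒m≤n+o d (ℕₚ.n≤1+n _)))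

-- Divisibility and coprimality

infix 4 _∣ₚ_
record _∣ₚ_ (f h : Poly) : Set where
  constructor divides
  field
    quotient : Poly
    equality : h ≋ pmul quotient f

∣ₚ-refl : ∀ {f} → f ∣ₚ f
∣ₚ-refl {f} = divides (pconst (+ 1)) (≋-sym (pmul-identityˡ f))

∣ₚ-trans : ∀ {f g h} → f ∣ₚ g → g ∣ₚ h → f ∣ₚ h
∣ₚ-trans {f} (divides a g≋af) (divides b h≋bg) =
  divides (pmul b a) (≋-trans h≋bg (≋-trans (pmul-congˡ b g≋af) (≋-sym (pmul-assoc b a f))))

∣ₚ-respʳ-≋ : ∀ {f g h} → g ≋ h → f ∣ₚ g → f ∣ₚ h
∣ₚ-respʳ-≋ g≋h (divides a g≋af) = divides a (≋-trans (≋-sym g≋h) g≋af)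

∣ₚ-respˡ-≋ : ∀ {f g h} → f ≋ g → f ∣ₚ h → g ∣ₚ h
∣ₚ-respˡ-≋ f≋g (divides a h≋af) = divides a (≋-trans h≋af (pmul-congˡ a f≋g))

∣ₚ-pmulʳ : ∀ f g → f ∣ₚ pmul f g
∣ₚ-pmulʳ f g = divides g (pmul-comm f g)

one-∣ₚ : ∀ h → pconst (+ 1) ∣ₚ h
one-∣ₚ h = divides h (≋-sym (≋-trans (pmul-comm h (pconst (+ 1))) (pmul-identityˡ h)))

∣ₚ-remainder : ∀ {g p q r} → p ≋ padd (pmul q g) r → g ∣ₚ p → g ∣ₚ r
∣ₚ-remainder {g} {p} {q} {r} p≋qg+r (divides h p≋hg) = divides (psub h q) (begin
  r                              ≈⟨ isolate q g r ⟩
  psub (padd (pmul q g) r) (pmul q g) ≈⟨ padd-congʳ (pneg (pmul q g)) (≋-trans (≋-sym p≋qg+r) p≋hg) ⟩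
  psub (pmul h g) (pmul q g)     ≈⟨ factor h q g ⟩
  pmul (psub h q) g              ∎)
  where
  open SetoidReasoning ≋-setoid
  isolate : ∀ q g r → r ≋ psub (padd (pmul q g) r) (pmul q g)
  isolate = solve-∀ Poly-ring
  factor : ∀ h q g → psub (pmul h g) (pmul q g) ≋ pmul (psub h q) g
  factor = solve-∀ Poly-ring

∣ₚ∧DegreeBelow⇒≋[] : ∀ {d g r} → Monic d g → DegreeBelow d r → g ∣ₚ r → r ≋ []
∣ₚ∧DegreeBelow⇒≋[] {d} mg deg (divides h r≋hg) = ≋-trans r≋hg (pmul-zeroˡ _ (DegreeBelow-zero
  (DegreeBelow-of-pmul-monic mg {s = h} (DegreeBelow-resp-≋ (≋-sym r≋hg) (DegreeBelow-mono (ℕₚ.m≤m+n d 0) deg)))))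

prem-≋[] : ∀ {d g} → Monic d g → ∀ {p} → g ∣ₚ p → prem p g ≋ []
prem-≋[] {g = g} mg {p} g∣p = ∣ₚ∧DegreeBelow⇒≋[] mg (proj₂ division)
  (∣ₚ-remainder {q = pquot p g} (proj₁ division) g∣p)
  where division = pdivMod-division mg p

pquot-exact : ∀ {d g} → Monic d g → ∀ {p} → g ∣ₚ p → p ≋ pmul (pquot p g) g
pquot-exact {g = g} mg {p} g∣p = ≋-trans (proj₁ (pdivMod-division mg p))
  (≋-trans (padd-congˡ (pmul (pquot p g) g) (prem-≋[] mg g∣p)) (padd-identityʳ _))

pmul-pconst : ∀ c p → pmul (pconst c) p ≋ pscale c p
pmul-pconst c p = ≋-trans (pmul-comm (pconst c) p) (pmul-singletonʳ c p)

∣ₚ-cancel-constant : ∀ {d f} → Monic d f → ∀ {c} → c ≢ + 0 → ∀ {a} → f ∣ₚ pmul (pconst c) a → f ∣ₚ a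
∣ₚ-cancel-constant {f = f} mf {c} c≢0 {a} f∣ca =
  divides q (≋-trans a≋qf+r (≋-trans (padd-congˡ (pmul q f) r≋0) (padd-identityʳ (pmul q f))))
  where
  q = pquot a f
  r = prem a f
  a≋qf+r = proj₁ (pdivMod-division mf a)
  deg-r = proj₂ (pdivMod-division mf a)
  distribute : ∀ c q f r → pmul c (padd (pmul q f) r) ≋ padd (pmul (pmul c q) f) (pmul c r)
  distribute = solve-∀ Poly-ring
  cr≋0 : pmul (pconst c) r ≋ []
  cr≋0 = ∣ₚ∧DegreeBelow⇒≋[] mf
    (DegreeBelow-resp-≋ (pmul-pconst c r) (degreeBelow λ i d≤i →
      trans (coeff-pscale c r i) (trans (cong (c ℤ.*_) (vanishes deg-r i d≤i)) (ℤₚ.*-zeroʳ c))))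
    (∣ₚ-remainder {q = pmul (pconst c) q} (≋-trans (pmul-congˡ (pconst c) a≋qf+r) (distribute (pconst c) q f r)) f∣ca)
  r≋0 : r ≋ []
  r≋0 = coeffwise λ i → [ ⊥-elim ∘ c≢0 , id ]′
    (ℤₚ.i*j≡0⇒i≡0∨j≡0 c (trans (sym (coeff-pscale c r i))
      (trans (sym (coeff-≡ (pmul-pconst c r) i)) (coeff-≡ cr≋0 i))))

-- Coprimality in ℚ[x], witnessed by a Bézout identity with a nonzero integer constant.
record Coprime (f g : Poly) : Set where
  constructor coprime
  field
    u v      : Poly
    c        : ℤ
    c≢0      : c ≢ + 0
    bézout   : padd (pmul u f) (pmul v g) ≋ pconst c

Coprime-∣ₚ-cancel : ∀ {d f b} → Monic d f → Coprime f b → ∀ {a} → f ∣ₚ pmul a b → f ∣ₚ a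
Coprime-∣ₚ-cancel {f = f} {b} mf (coprime u v c c≢0 bézout) {a} (divides w ab≋wf) =
  ∣ₚ-cancel-constant mf c≢0 {a} (divides (padd (pmul u a) (pmul v w)) (begin
    pmul (pconst c) a                                   ≈⟨ pmul-congʳ a bézout ⟨
    pmul (padd (pmul u f) (pmul v b)) a                 ≈⟨ expand u f v b a ⟩
    padd (pmul (pmul u a) f) (pmul v (pmul a b))        ≈⟨ padd-congˡ (pmul (pmul u a) f) (pmul-congˡ v ab≋wf) ⟩
    padd (pmul (pmul u a) f) (pmul v (pmul w f))        ≈⟨ collect u a f v w ⟩
    pmul (padd (pmul u a) (pmul v w)) f                 ∎))
  where
  open SetoidReasoning ≋-setoid
  expand : ∀ u f v b a → pmul (padd (pmul u f) (pmul v b)) a ≋ padd (pmul (pmul u a) f) (pmul v (pmul a b))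
  expand = solve-∀ Poly-ring
  collect : ∀ u a f v w → padd (pmul (pmul u a) f) (pmul v (pmul w f)) ≋ pmul (padd (pmul u a) (pmul v w)) f
  collect = solve-∀ Poly-ring

pmul-∣ₚ : ∀ {d f b h} → Monic d f → Coprime f b → b ∣ₚ h → f ∣ₚ h → pmul f b ∣ₚ h
pmul-∣ₚ {f = f} {b} {h} mf cop (divides a h≋ab) f∣h =
  divides q (≋-trans h≋ab (≋-trans (pmul-congʳ b a≋qf) (pmul-assoc q f b)))
  where
  f∣a : f ∣ₚ a
  f∣a = Coprime-∣ₚ-cancel mf cop {a} (∣ₚ-respʳ-≋ {f} {h} {pmul a b} h≋ab f∣h)
  open _∣ₚ_ f∣a renaming (quotient to q; equality to a≋qf)

Coprime-pmul : ∀ {f g₁ g₂} → Coprime f g₁ → Coprime f g₂ → Coprime f (pmul g₁ g₂)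
Coprime-pmul {f} {g₁} {g₂} (coprime u₁ v₁ c₁ c₁≢0 e₁) (coprime u₂ v₂ c₂ c₂≢0 e₂) = coprime
  (padd (padd (pmul (pmul u₁ u₂) f) (pmul u₁ (pmul v₂ g₂))) (pmul (pmul v₁ g₁) u₂)) (pmul v₁ v₂) (c₁ ℤ.* c₂)
  (λ c₁c₂≡0 → [ c₁≢0 , c₂≢0 ]′ (ℤₚ.i*j≡0⇒i≡0∨j≡0 c₁ c₁c₂≡0))
  (≋-trans (regroup u₁ u₂ v₁ v₂ f g₁ g₂) (≋-trans (pmul-cong e₁ e₂) (∷-≋ (ℤₚ.+-identityʳ _) ≋-refl)))
  where
  regroup : ∀ u₁ u₂ v₁ v₂ f g₁ g₂ →
    padd (pmul (padd (padd (pmul (pmul u₁ u₂) f) (pmul u₁ (pmul v₂ g₂))) (pmul (pmul v₁ g₁) u₂)) f)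
         (pmul (pmul v₁ v₂) (pmul g₁ g₂))
    ≋ pmul (padd (pmul u₁ f) (pmul v₁ g₁)) (padd (pmul u₂ f) (pmul v₂ g₂))
  regroup = solve-∀ Poly-ring

Coprime-∣ₚ : ∀ {f g h} → Coprime f h → g ∣ₚ h → Coprime f g
Coprime-∣ₚ {f} {g} (coprime u v c c≢0 e) (divides w h≋wg) =
  coprime u (pmul v w) c c≢0 (≋-trans (padd-congˡ (pmul u f) (≋-trans (pmul-assoc v w g) (pmul-congˡ v (≋-sym h≋wg)))) e)

Coprime-one : ∀ {f} → Coprime f (pconst (+ 1))
Coprime-one = coprime [] (pconst (+ 1)) (+ 1) (λ ()) (pmul-identityˡ _)

Coprime-respʳ-≋ : ∀ {f g h} → g ≋ h → Coprime f h → Coprime f g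
Coprime-respʳ-≋ {f} g≋h (coprime u v c c≢0 e) = coprime u v c c≢0 (≋-trans (padd-congˡ (pmul u f) (pmul-congˡ v g≋h)) e)

-- Congruences and the polynomials xⁿ − 1

infix 4 _≈_mod_
record _≈_mod_ (a b m : Poly) : Set where
  constructor congruent
  field difference-∣ₚ : m ∣ₚ psub a b

≋⇒≈mod : ∀ {m a b} → a ≋ b → a ≈ b mod m
≋⇒≈mod {m} {a} {b} a≋b = congruent (divides [] (≋-trans (padd-congʳ (pneg b) a≋b) (pneg-inverseʳ b)))

≈mod-trans : ∀ {m a b c} → a ≈ b mod m → b ≈ c mod m → a ≈ c mod m
≈mod-trans {m} {a} {b} {c} (congruent (divides q₁ e₁)) (congruent (divides q₂ e₂)) = congruent (divides (padd q₁ q₂)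
  (≋-trans (telescope a b c) (≋-trans (padd-cong e₁ e₂) (collect q₁ q₂ m))))
  where
  telescope : ∀ a b c → psub a c ≋ padd (psub a b) (psub b c)
  telescope = solve-∀ Poly-ring
  collect : ∀ q₁ q₂ m → padd (pmul q₁ m) (pmul q₂ m) ≋ pmul (padd q₁ q₂) m
  collect = solve-∀ Poly-ring

≈mod-padd : ∀ {m a b c d} → a ≈ b mod m → c ≈ d mod m → padd a c ≈ padd b d mod m
≈mod-padd {m} {a} {b} {c} {d} (congruent (divides q₁ e₁)) (congruent (divides q₂ e₂)) = congruent (divides (padd q₁ q₂)
  (≋-trans (regroup a b c d) (≋-trans (padd-cong e₁ e₂) (collect q₁ q₂ m))))
  where
  regroup : ∀ a b c d → psub (padd a c) (padd b d) ≋ padd (psub a b) (psub c d)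
  regroup = solve-∀ Poly-ring
  collect : ∀ q₁ q₂ m → padd (pmul q₁ m) (pmul q₂ m) ≋ pmul (padd q₁ q₂) m
  collect = solve-∀ Poly-ring

≈mod-pmul : ∀ {m a b} w → a ≈ b mod m → pmul w a ≈ pmul w b mod m
≈mod-pmul {m} {a} {b} w (congruent (divides q e)) = congruent (divides (pmul w q)
  (≋-trans (factor w a b) (≋-trans (pmul-congˡ w e) (≋-sym (pmul-assoc w q m)))))
  where
  factor : ∀ w a b → psub (pmul w a) (pmul w b) ≋ pmul w (psub a b)
  factor = solve-∀ Poly-ring

X^ : ℕ → Poly
X^ n = monomial n (+ 1)

X^-+ : ∀ a b → X^ (a + b) ≋ pmul (X^ a) (X^ b)
X^-+ zero    b = ≋-sym (pmul-identityˡ (X^ b))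
X^-+ (suc a) b = ≋-trans (pshift-cong (X^-+ a b)) (≋-sym (pmul-pshiftˡ (X^ a) (X^ b)))

X^-period : ∀ k j → X^ (j + k) ≈ X^ j mod xpowMinus1 k
X^-period k j = congruent (divides (X^ j) (≋-trans (padd-congʳ (pneg (X^ j)) (X^-+ j k)) (factor (X^ j) (X^ k))))
  where
  factor : ∀ a b → psub (pmul a b) a ≋ pmul a (psub b (pconst (+ 1)))
  factor = solve-∀ Poly-ring

pconst-X^-period : ∀ k c → pmul (pconst c) (X^ k) ≈ pconst c mod xpowMinus1 k
pconst-X^-period k c = ≈mod-trans (≈mod-pmul (pconst c) (X^-period k 0))
  (≋⇒≈mod (≋-trans (pmul-comm (pconst c) (X^ 0)) (pmul-identityˡ (pconst c))))

Monic-xpowMinus1 : ∀ {n} → 0 < n → Monic n (xpowMinus1 n)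
Monic-xpowMinus1 {suc n} _ = monic (trans (coeff-high (suc n) (s≤s z≤n)) (coeff-monomial (suc n) (+ 1)))
  (degreeBelow λ i n<i → trans (coeff-high i (ℕₚ.≤-trans (s≤s z≤n) n<i)) (vanishes (monomial-degreeBelow (suc n) (+ 1)) i n<i))
  where
  coeff-high : ∀ i → 1 ≤ i → coeff (xpowMinus1 (suc n)) i ≡ coeff (X^ (suc n)) i
  coeff-high (suc i) _ = trans (coeff-padd (X^ (suc n)) (pconst (ℤ.- + 1)) (suc i)) (ℤₚ.+-identityʳ _)

xpowMinus1-+ : ∀ d b → xpowMinus1 (d + b) ≋ padd (pmul (X^ d) (xpowMinus1 b)) (xpowMinus1 d)
xpowMinus1-+ d b = ≋-trans (padd-congʳ (pconst (ℤ.- + 1)) (X^-+ d b)) (peel (X^ d) (X^ b))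
  where
  peel : ∀ a b → psub (pmul a b) (pconst (+ 1)) ≋ padd (pmul a (psub b (pconst (+ 1)))) (psub a (pconst (+ 1)))
  peel = solve-∀ Poly-ring

geometricSum : ℕ → ℕ → Poly
geometricSum g zero    = []
geometricSum g (suc q) = padd (pconst (+ 1)) (pmul (X^ g) (geometricSum g q))

xpowMinus1-geometric : ∀ g q → xpowMinus1 (q * g) ≋ pmul (geometricSum g q) (xpowMinus1 g)
xpowMinus1-geometric g zero    = pshift-zero ≋-refl
xpowMinus1-geometric g (suc q) = begin
  xpowMinus1 (g + q * g)                                       ≈⟨ xpowMinus1-+ g (q * g) ⟩
  padd (pmul (X^ g) (xpowMinus1 (q * g))) (xpowMinus1 g)       ≈⟨ padd-congʳ (xpowMinus1 g) (pmul-congˡ (X^ g) (xpowMinus1-geometric g q)) ⟩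
  padd (pmul (X^ g) (pmul (geometricSum g q) (xpowMinus1 g))) (xpowMinus1 g)
                                                               ≈⟨ collect (X^ g) (geometricSum g q) (xpowMinus1 g) ⟩
  pmul (geometricSum g (suc q)) (xpowMinus1 g)                 ∎
  where
  open SetoidReasoning ≋-setoid
  collect : ∀ a s m → padd (pmul a (pmul s m)) m ≋ pmul (padd (pconst (+ 1)) (pmul a s)) m
  collect = solve-∀ Poly-ring

geometricSum-≈ : ∀ g q → geometricSum g q ≈ pconst (+ q) mod xpowMinus1 g
geometricSum-≈ g zero    = ≋⇒≈mod (≋-sym (pshift-zero ≋-refl))
geometricSum-≈ g (suc q) = ≈mod-padd (≋⇒≈mod (≋-refl {pconst (+ 1)}))
  (≈mod-trans (≈mod-pmul (X^ g) (geometricSum-≈ g q))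
    (≈mod-trans (≋⇒≈mod (pmul-comm (X^ g) (pconst (+ q)))) (pconst-X^-period g (+ q))))

xpowMinus1-∣ₚ : ∀ {d k} → d ∣ k → xpowMinus1 d ∣ₚ xpowMinus1 k
xpowMinus1-∣ₚ {d} (divides q refl) = divides (geometricSum d q) (xpowMinus1-geometric d q)

xpowMinus1-bézout : ∀ {d m n} x y → d + y * n ≡ x * m →
  xpowMinus1 d ≋ padd (pmul (geometricSum m x) (xpowMinus1 m)) (pmul (pneg (pmul (X^ d) (geometricSum n y))) (xpowMinus1 n))
xpowMinus1-bézout {d} {m} {n} x y d+yn≡xm = begin
  xpowMinus1 d                                                   ≈⟨ isolate D X G N ⟩
  padd (padd (pmul X (pmul G N)) D) (pmul (pneg (pmul X G)) N)   ≈⟨ padd-congʳ (pmul (pneg (pmul X G)) N) xm-expanded ⟨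
  padd (xpowMinus1 (x * m)) (pmul (pneg (pmul X G)) N)           ≈⟨ padd-congʳ (pmul (pneg (pmul X G)) N) (xpowMinus1-geometric m x) ⟩
  padd (pmul (geometricSum m x) (xpowMinus1 m)) (pmul (pneg (pmul X G)) N) ∎
  where
  open SetoidReasoning ≋-setoid
  D = xpowMinus1 d
  X = X^ d
  G = geometricSum n y
  N = xpowMinus1 n
  isolate : ∀ D X G N → D ≋ padd (padd (pmul X (pmul G N)) D) (pmul (pneg (pmul X G)) N)
  isolate = solve-∀ Poly-ring
  xm-expanded : xpowMinus1 (x * m) ≋ padd (pmul X (pmul G N)) D
  xm-expanded = subst (λ e → xpowMinus1 e ≋ padd (pmul X (pmul G N)) D) d+yn≡xm
    (≋-trans (xpowMinus1-+ d (y * n)) (padd-congʳ D (pmul-congˡ X (xpowMinus1-geometric n y))))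

xpowMinus1-gcd : ∀ m n → ∃₂ λ u v → xpowMinus1 (gcd m n) ≋ padd (pmul u (xpowMinus1 m)) (pmul v (xpowMinus1 n))
xpowMinus1-gcd m n with Bézout.identity (gcd-GCD m n)
... | Bézout.+- x y d+yn≡xm = geometricSum m x , pneg (pmul (X^ (gcd m n)) (geometricSum n y)) , xpowMinus1-bézout x y d+yn≡xm
... | Bézout.-+ x y d+xm≡yn = pneg (pmul (X^ (gcd m n)) (geometricSum m x)) , geometricSum n y ,
  ≋-trans (xpowMinus1-bézout y x d+xm≡yn) (padd-comm (pmul (geometricSum n y) (xpowMinus1 n)) _)

Coprime-of-≈-constant : ∀ {f g} w {c} → pmul w f ≈ pconst c mod g → c ≢ + 0 → Coprime f g
Coprime-of-≈-constant {f} {g} w {c} (congruent (divides s wf-c≋sg)) c≢0 = coprime w (pneg s) c c≢0 (begin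
  padd (pmul w f) (pmul (pneg s) g)                     ≈⟨ regroup (pmul w f) (pconst c) s g ⟩
  padd (psub (psub (pmul w f) (pconst c)) (pmul s g)) (pconst c)
    ≈⟨ padd-congʳ (pconst c) (≋-trans (padd-congʳ (pneg (pmul s g)) wf-c≋sg) (pneg-inverseʳ (pmul s g))) ⟩
  pconst c                                              ∎)
  where
  open SetoidReasoning ≋-setoid
  regroup : ∀ a c s g → padd a (pmul (pneg s) g) ≋ padd (psub (psub a c) (pmul s g)) c
  regroup = solve-∀ Poly-ring

Coprime-of-combination : ∀ {f x y} → Coprime f x → ∀ a b → x ≋ padd (pmul a f) (pmul b y) → Coprime f y
Coprime-of-combination {f} {x} {y} (coprime u v c c≢0 e) a b x≋af+by = coprime (padd u (pmul v a)) (pmul v b) c c≢0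
  (≋-trans (≋-sym (regroup u v f a b y)) (≋-trans (padd-congˡ (pmul u f) (pmul-congˡ v (≋-sym x≋af+by))) e))
  where
  regroup : ∀ u v f a b y → padd (pmul u f) (pmul v (padd (pmul a f) (pmul b y)))
                            ≋ padd (pmul (padd u (pmul v a)) f) (pmul (pmul v b) y)
  regroup = solve-∀ Poly-ring

-- With g = gcd e i, e = q·g and d = w·(x^g − 1), cancelling x^g − 1 gives
-- w·f = (x^e − 1)/(x^g − 1) ≡ q modulo x^g − 1, so f is coprime to x^g − 1;
-- the Bézout identity for x^g − 1 then transfers this to x^i − 1.
Coprime-xpowMinus1 : ∀ {e i d f} → 0 < e → pmul d f ≋ xpowMinus1 e → xpowMinus1 (gcd e i) ∣ₚ d →
                     Coprime f (xpowMinus1 i)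
Coprime-xpowMinus1 {e} {i} {d} {f} 0<e df≋xᵉ-1 (divides w d≋w[xᵍ-1]) with gcd[m,n]∣m e i
... | divides q e≡qg = Coprime-of-combination f⊥xᵍ-1 (pmul u d) v (≋-trans bézout
      (padd-congʳ (pmul v (xpowMinus1 i)) (≋-trans (pmul-congˡ u (≋-sym df≋xᵉ-1)) (≋-sym (pmul-assoc u d f)))))
  where
  g = gcd e i
  xᵍ-1 = xpowMinus1 g
  0<g : 0 < g
  0<g = ℕₚ.n≢0⇒n>0 (gcd[m,n]≢0 e i (inj₁ (ℕₚ.n>0⇒n≢0 0<e)))
  wf≋geometricSum : pmul w f ≋ geometricSum g q
  wf≋geometricSum = pmul-cancelʳ-monic (Monic-xpowMinus1 0<g) (pmul w f) (geometricSum g q) (begin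
    pmul (pmul w f) xᵍ-1          ≈⟨ swap w f xᵍ-1 ⟩
    pmul (pmul w xᵍ-1) f          ≈⟨ pmul-congʳ f d≋w[xᵍ-1] ⟨
    pmul d f                      ≈⟨ df≋xᵉ-1 ⟩
    xpowMinus1 e                  ≡⟨ cong xpowMinus1 e≡qg ⟩
    xpowMinus1 (q * g)            ≈⟨ xpowMinus1-geometric g q ⟩
    pmul (geometricSum g q) xᵍ-1  ∎)
    where
    open SetoidReasoning ≋-setoid
    swap : ∀ w f x → pmul (pmul w f) x ≋ pmul (pmul w x) f
    swap = solve-∀ Poly-ring
  q≢0 : + q ≢ + 0
  q≢0 q≡0 = ℕₚ.n>0⇒n≢0 0<e (trans e≡qg (cong (_* g) (ℤₚ.+-injective q≡0)))
  f⊥xᵍ-1 : Coprime f xᵍ-1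
  f⊥xᵍ-1 = Coprime-of-≈-constant w (≈mod-trans (≋⇒≈mod wf≋geometricSum) (geometricSum-≈ g q)) q≢0
  u = proj₁ (xpowMinus1-gcd e i)
  v = proj₁ (proj₂ (xpowMinus1-gcd e i))
  bézout = proj₂ (proj₂ (xpowMinus1-gcd e i))

-- The cyclotomic polynomials

Φ : ℕ → Poly
Φ = cyclotomic

product : List (ℕ × Poly) → Poly
product = foldr (λ dp acc → pmul (proj₂ dp) acc) (pconst (+ 1))

-- The product of the Φ d with d ≤ n and d ∣ m; for m = n + 1 it is the divisor of xⁿ⁺¹ − 1 that
-- defines Φ (n + 1) in cycloTable.
divisorProduct : ℕ → ℕ → Poly
divisorProduct m n = product (filter ((_∣? m) ∘ proj₁) (cycloTable n))

Φ-suc : ∀ n → Φ (suc n) ≡ normalize (pquot (xpowMinus1 (suc n)) (divisorProduct (suc n) n))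
Φ-suc n = lastPoly-∷ʳ (cycloTable n) (suc n , normalize (pquot (xpowMinus1 (suc n)) (divisorProduct (suc n) n)))
  where
  lastPoly-∷ʳ : ∀ l x → lastPoly (l ++ x ∷ []) ≡ proj₂ x
  lastPoly-∷ʳ []          x = refl
  lastPoly-∷ʳ (y ∷ [])    x = refl
  lastPoly-∷ʳ (y ∷ z ∷ l) x = lastPoly-∷ʳ (z ∷ l) x

cycloTable-suc : ∀ n → cycloTable (suc n) ≡ cycloTable n ++ (suc n , Φ (suc n)) ∷ []
cycloTable-suc n = cong (λ φ → cycloTable n ++ (suc n , φ) ∷ []) (sym (Φ-suc n))

product-++ : ∀ xs ys → product (xs ++ ys) ≋ pmul (product xs) (product ys)
product-++ []       ys = ≋-sym (pmul-identityˡ (product ys))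
product-++ (x ∷ xs) ys =
  ≋-trans (pmul-congˡ (proj₂ x) (product-++ xs ys)) (≋-sym (pmul-assoc (proj₂ x) (product xs) (product ys)))

divisorProduct-suc : ∀ m n → divisorProduct m (suc n) ≋
                     pmul (divisorProduct m n) (product (filter ((_∣? m) ∘ proj₁) ((suc n , Φ (suc n)) ∷ [])))
divisorProduct-suc m n = begin
  product (filter P? (cycloTable (suc n)))                     ≡⟨ cong (product ∘ filter P?) (cycloTable-suc n) ⟩
  product (filter P? (cycloTable n ++ last))                   ≡⟨ cong product (filter-++ P? (cycloTable n) last) ⟩
  product (filter P? (cycloTable n) ++ filter P? last)         ≈⟨ product-++ (filter P? (cycloTable n)) (filter P? last) ⟩
  pmul (divisorProduct m n) (product (filter P? last))         ∎
  where
  open SetoidReasoning ≋-setoid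
  P? = (_∣? m) ∘ proj₁
  last = (suc n , Φ (suc n)) ∷ []

divisorProduct-suc-∣ : ∀ m n → suc n ∣ m → divisorProduct m (suc n) ≋ pmul (divisorProduct m n) (Φ (suc n))
divisorProduct-suc-∣ m n sn∣m = ≋-trans (divisorProduct-suc m n)
  (pmul-congˡ (divisorProduct m n) (subst (λ l → product l ≋ Φ (suc n)) (sym (filter-accept ((_∣? m) ∘ proj₁) sn∣m))
    (≋-trans (pmul-comm (Φ (suc n)) (pconst (+ 1))) (pmul-identityˡ (Φ (suc n))))))

divisorProduct-suc-∤ : ∀ m n → ¬ suc n ∣ m → divisorProduct m (suc n) ≋ divisorProduct m n
divisorProduct-suc-∤ m n sn∤m = ≋-trans (divisorProduct-suc m n)
  (≋-trans (pmul-congˡ (divisorProduct m n)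
             (subst (λ l → product l ≋ pconst (+ 1)) (sym (filter-reject ((_∣? m) ∘ proj₁) sn∤m)) ≋-refl))
    (≋-trans (pmul-comm (divisorProduct m n) (pconst (+ 1))) (pmul-identityˡ (divisorProduct m n))))

record CyclotomicFacts (n : ℕ) : Set where
  field
    Φ-degree        : ℕ
    Φ-monic         : Monic Φ-degree (Φ (suc n))
    Φ-factorization : pmul (divisorProduct (suc n) n) (Φ (suc n)) ≋ xpowMinus1 (suc n)
    Φ-coprime       : ∀ {i} → i < n → Coprime (Φ (suc n)) (Φ (suc i))

CyclotomicFactsBelow : ℕ → Set
CyclotomicFactsBelow = WfRec _<_ CyclotomicFacts

below-suc : ∀ {j} → CyclotomicFactsBelow (suc j) → CyclotomicFactsBelow j
below-suc facts i<j = facts (ℕₚ.m<n⇒m<1+n i<j)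

divisorProduct-monic : ∀ {j} → CyclotomicFactsBelow j → ∀ m → ∃ λ d → Monic d (divisorProduct m j)
divisorProduct-monic {zero}  _     m = 0 , monic refl (degreeBelow λ { (suc i) _ → refl })
divisorProduct-monic {suc j} facts m with suc j ∣? m | divisorProduct-monic (below-suc facts) m
... | yes sj∣m | d , mD = d + Φ-degree , Monic-resp-≋ (divisorProduct-suc-∣ m j sj∣m) (Monic-pmul Φ-monic mD)
  where open CyclotomicFacts (facts ℕₚ.≤-refl)
... | no  sj∤m | d , mD = d , Monic-resp-≋ (divisorProduct-suc-∤ m j sj∤m) mD

Φ-∣ₚ-divisorProduct : ∀ {i j m} → i < j → suc i ∣ m → Φ (suc i) ∣ₚ divisorProduct m j
Φ-∣ₚ-divisorProduct {i} {suc j} {m} i<sj si∣m with ℕₚ.m≤n⇒m<n∨m≡n (ℕₚ.≤-pred i<sj)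
... | inj₂ refl = ∣ₚ-respʳ-≋ (≋-trans (pmul-comm (Φ (suc i)) (divisorProduct m i)) (≋-sym (divisorProduct-suc-∣ m i si∣m)))
                    (∣ₚ-pmulʳ (Φ (suc i)) (divisorProduct m i))
... | inj₁ i<j  = ∣ₚ-trans (Φ-∣ₚ-divisorProduct i<j si∣m) step
  where
  step : divisorProduct m j ∣ₚ divisorProduct m (suc j)
  step with suc j ∣? m
  ... | yes sj∣m = ∣ₚ-respʳ-≋ (≋-sym (divisorProduct-suc-∣ m j sj∣m)) (∣ₚ-pmulʳ (divisorProduct m j) (Φ (suc j)))
  ... | no  sj∤m = ∣ₚ-respʳ-≋ (≋-sym (divisorProduct-suc-∤ m j sj∤m)) ∣ₚ-refl

Coprime-divisorProduct : ∀ {f j} → (∀ {i} → i < j → Coprime f (Φ (suc i))) → ∀ m → Coprime f (divisorProduct m j)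
Coprime-divisorProduct {j = zero}  _   m = Coprime-one
Coprime-divisorProduct {j = suc j} cop m with suc j ∣? m
... | yes sj∣m = Coprime-respʳ-≋ (divisorProduct-suc-∣ m j sj∣m)
                   (Coprime-pmul (Coprime-divisorProduct (λ i<j → cop (ℕₚ.m<n⇒m<1+n i<j)) m) (cop ℕₚ.≤-refl))
... | no  sj∤m = Coprime-respʳ-≋ (divisorProduct-suc-∤ m j sj∤m) (Coprime-divisorProduct (λ i<j → cop (ℕₚ.m<n⇒m<1+n i<j)) m)

divisorProduct-∣ₚ : ∀ {j} → CyclotomicFactsBelow j → ∀ {m h} →
                    (∀ {i} → i < j → suc i ∣ m → Φ (suc i) ∣ₚ h) → divisorProduct m j ∣ₚ h
divisorProduct-∣ₚ {zero}  _     {h = h} _   = one-∣ₚ h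
divisorProduct-∣ₚ {suc j} facts {m} {h} Φ∣h with suc j ∣? m
... | yes sj∣m = ∣ₚ-respˡ-≋ (≋-trans (pmul-comm (Φ (suc j)) (divisorProduct m j)) (≋-sym (divisorProduct-suc-∣ m j sj∣m)))
                   (pmul-∣ₚ Φ-monic (Coprime-divisorProduct Φ-coprime m) rest (Φ∣h ℕₚ.≤-refl sj∣m))
  where
  open CyclotomicFacts (facts ℕₚ.≤-refl)
  rest = divisorProduct-∣ₚ (below-suc facts) (λ i<j → Φ∣h (ℕₚ.m<n⇒m<1+n i<j))
... | no  sj∤m = ∣ₚ-respˡ-≋ (≋-sym (divisorProduct-suc-∤ m j sj∤m))
                   (divisorProduct-∣ₚ (below-suc facts) (λ i<j → Φ∣h (ℕₚ.m<n⇒m<1+n i<j)))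

Φ-∣ₚ-xpowMinus1 : ∀ {n} → CyclotomicFacts n → Φ (suc n) ∣ₚ xpowMinus1 (suc n)
Φ-∣ₚ-xpowMinus1 {n} facts = divides (divisorProduct (suc n) n) (≋-sym (CyclotomicFacts.Φ-factorization facts))

xpowMinus1-∣ₚ-divisorProduct : ∀ {n} → CyclotomicFactsBelow n → ∀ {g m} → 0 < g → g ≤ n → g ∣ m →
                               xpowMinus1 g ∣ₚ divisorProduct m n
xpowMinus1-∣ₚ-divisorProduct facts {suc g} {m} _ g<n g∣m = ∣ₚ-respˡ-≋
  (≋-trans (divisorProduct-suc-∣ (suc g) g ∣-refl) (CyclotomicFacts.Φ-factorization (facts g<n)))
  (divisorProduct-∣ₚ (λ i<sg → facts (ℕₚ.<-≤-trans i<sg g<n))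
    (λ i<sg si∣sg → Φ-∣ₚ-divisorProduct (ℕₚ.<-≤-trans i<sg g<n) (∣-trans si∣sg g∣m)))

cyclotomicFacts-step : ∀ n → CyclotomicFactsBelow n → CyclotomicFacts n
cyclotomicFacts-step n facts = record
  { Φ-degree        = suc n ∸ proj₁ D-monic
  ; Φ-monic         = subst (Monic _) (sym (Φ-suc n)) (Monic-quotient (normalize Q) (proj₂ D-monic) (Monic-xpowMinus1 (s≤s z≤n))
                        (≋-trans (pmul-congʳ D (normalize-≋ Q)) (≋-sym xⁿ-1≋QD)))
  ; Φ-factorization = factorization
  ; Φ-coprime       = coprime-smaller
  }
  where
  D = divisorProduct (suc n) n
  Q = pquot (xpowMinus1 (suc n)) D
  D-monic = divisorProduct-monic facts (suc n)
  D∣xⁿ-1 : D ∣ₚ xpowMinus1 (suc n)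
  D∣xⁿ-1 = divisorProduct-∣ₚ facts λ i<n si∣sn → ∣ₚ-trans (Φ-∣ₚ-xpowMinus1 (facts i<n)) (xpowMinus1-∣ₚ si∣sn)
  xⁿ-1≋QD : xpowMinus1 (suc n) ≋ pmul Q D
  xⁿ-1≋QD = pquot-exact (proj₂ D-monic) D∣xⁿ-1
  factorization : pmul D (Φ (suc n)) ≋ xpowMinus1 (suc n)
  factorization = subst (λ φ → pmul D φ ≋ xpowMinus1 (suc n)) (sym (Φ-suc n))
    (≋-trans (pmul-congˡ D (normalize-≋ Q)) (≋-trans (pmul-comm D Q) (≋-sym xⁿ-1≋QD)))
  coprime-smaller : ∀ {i} → i < n → Coprime (Φ (suc n)) (Φ (suc i))
  coprime-smaller {i} i<n =
    Coprime-∣ₚ (Coprime-xpowMinus1 {suc n} {suc i} (s≤s z≤n) factorization xᵍ-1∣D) (Φ-∣ₚ-xpowMinus1 (facts i<n))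
    where
    xᵍ-1∣D : xpowMinus1 (gcd (suc n) (suc i)) ∣ₚ D
    xᵍ-1∣D = xpowMinus1-∣ₚ-divisorProduct facts (ℕₚ.n≢0⇒n>0 (gcd[m,n]≢0 (suc n) (suc i) (inj₁ λ ())))
               (ℕₚ.≤-trans (∣⇒≤ (gcd[m,n]∣n (suc n) (suc i))) i<n) (gcd[m,n]∣m (suc n) (suc i))

cyclotomicFacts : ∀ n → CyclotomicFacts n
cyclotomicFacts = <-rec CyclotomicFacts cyclotomicFacts-step

evaluatesTo-≈ : ∀ k e α → evalPoly e ≈ pconst α mod xpowMinus1 (suc k) → EvaluatesTo (suc k) e α
evaluatesTo-≈ k e α (congruent xᵏ-1∣e-α) =
  normalize-zero (prem-≋[] Φ-monic (∣ₚ-trans (Φ-∣ₚ-xpowMinus1 facts) xᵏ-1∣e-α))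
  where
  facts = cyclotomicFacts k
  open CyclotomicFacts facts

-- Binary expressions

-- pow j represents x^(j+1): with exponents shifted by one, prev k cycles through k, …, 0.
pow : ℕ → Expr
pow zero    = var
pow (suc j) = var ⊗ pow j

prev : ℕ → ℕ → ℕ
prev k zero    = k
prev k (suc j) = j

size-pow : ∀ j → size (pow j) ≡ suc j
size-pow zero    = refl
size-pow (suc j) = cong suc (size-pow j)

evalPoly-pow : ∀ j → evalPoly (pow j) ≋ X^ (suc j)
evalPoly-pow zero    = ≋-refl
evalPoly-pow (suc j) = ≋-trans (pmul-congˡ pX (evalPoly-pow j)) (≋-sym (X^-+ 1 (suc j)))

two : Expr
two = var ⊕ var

withDigit : ℕ → ℕ → Expr → Expr
withDigit zero    j e = e
withDigit (suc _) j e = e ⊕ pow j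

size-withDigit : ∀ r j e → size (withDigit r j e) ≤ size e + suc j
size-withDigit zero    j e = ℕₚ.m≤m+n (size e) (suc j)
size-withDigit (suc _) j e = ℕₚ.≤-reflexive (cong (λ n → size e + n) (size-pow j))

evalPoly-withDigit : ∀ {r} j e → r < 2 → evalPoly (withDigit r j e) ≋ padd (evalPoly e) (pmul (pconst (+ r)) (X^ (suc j)))
evalPoly-withDigit {zero} j e _ = ≋-sym (≋-trans
  (padd-congˡ (evalPoly e) (≋-trans (pmul-pconst (+ 0) (X^ (suc j))) (pscale-zeroˡ (X^ (suc j)))))
  (padd-identityʳ (evalPoly e)))
evalPoly-withDigit {suc zero} j e _ = padd-congˡ (evalPoly e) (≋-trans (evalPoly-pow j) (≋-sym (pmul-identityˡ (X^ (suc j)))))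
evalPoly-withDigit {suc (suc _)} j e (s≤s (s≤s ()))

X^-prev : ∀ k j → X^ (suc (suc (prev k j))) ≈ X^ (suc j) mod xpowMinus1 (suc k)
X^-prev k zero    = X^-period (suc k) 1
X^-prev k (suc j) = ≋⇒≈mod ≋-refl

binaryExpr : ℕ → ℕ → ℕ → ℕ → Expr
binaryExpr k zero    m               j = pow j
binaryExpr k (suc b) zero            j = pow j
binaryExpr k (suc b) (suc zero)      j = pow j
binaryExpr k (suc b) m@(suc (suc _)) j = withDigit (m % 2) j (two ⊗ binaryExpr k b (m / 2) (prev k j))

double-shift : ∀ k j h e → evalPoly e ≈ pmul (pconst (+ h)) (X^ (suc (prev k j))) mod xpowMinus1 (suc k) →
               evalPoly (two ⊗ e) ≈ pmul (pconst (+ (h + h))) (X^ (suc j)) mod xpowMinus1 (suc k)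
double-shift k j h e e≈hY = ≈mod-trans (≈mod-pmul (padd pX pX) e≈hY)
  (≈mod-trans (≋⇒≈mod (≋-trans (regroup pX H Y) (pmul-congˡ (padd H H) (≋-sym (X^-+ 1 (suc (prev k j)))))))
    (≈mod-pmul (padd H H) (X^-prev k j)))
  where
  H = pconst (+ h)
  Y = X^ (suc (prev k j))
  regroup : ∀ x H Y → pmul (padd x x) (pmul H Y) ≋ pmul (padd H H) (pmul x Y)
  regroup = solve-∀ Poly-ring

halving : ∀ m → m ≡ m / 2 + m / 2 + m % 2
halving m = trans (m≡m%n+[m/n]*n m 2) (rearrange (m % 2) (m / 2))
  where
  rearrange : ∀ r h → r + h * 2 ≡ h + h + r
  rearrange = ℕ-solve-∀

⌈log₂⌉-halve : ∀ m → 2 ≤ m → suc ⌈log₂ (m / 2) ⌉ ≤ ⌈log₂ m ⌉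
⌈log₂⌉-halve m 2≤m = begin
  suc ⌈log₂ (m / 2) ⌉     ≡⟨ ⌈log₂2*n⌉≡1+⌈log₂n⌉ (m / 2) {{ℕ.>-nonZero (m≥n⇒m/n>0 2≤m)}} ⟨
  ⌈log₂ (2 * (m / 2)) ⌉   ≤⟨ ⌈log₂⌉-mono-≤ 2[m/2]≤m ⟩
  ⌈log₂ m ⌉               ∎
  where
  open ℕₚ.≤-Reasoning
  double : ∀ h → 2 * h ≡ h + h
  double = ℕ-solve-∀
  2[m/2]≤m : 2 * (m / 2) ≤ m
  2[m/2]≤m = subst (2 * (m / 2) ≤_) (sym (halving m))
    (ℕₚ.≤-trans (ℕₚ.≤-reflexive (double (m / 2))) (ℕₚ.m≤m+n _ (m % 2)))

⌈log₂⌉-positive : ∀ m → 1 ≤ ⌈log₂ suc (suc m) ⌉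
⌈log₂⌉-positive m = ⌈log₂⌉-mono-≤ {2} {suc (suc m)} (s≤s (s≤s z≤n))

binaryExpr-≈ : ∀ k b m j → 0 < m → ⌈log₂ m ⌉ ≤ b →
               evalPoly (binaryExpr k b m j) ≈ pmul (pconst (+ m)) (X^ (suc j)) mod xpowMinus1 (suc k)
binaryExpr-≈ k zero (suc zero) j _ _ = ≋⇒≈mod (≋-trans (evalPoly-pow j) (≋-sym (pmul-identityˡ (X^ (suc j)))))
binaryExpr-≈ k zero (suc (suc m)) j _ log≤0 with () ← ℕₚ.≤-trans (⌈log₂⌉-positive m) log≤0
binaryExpr-≈ k (suc b) (suc zero) j _ _ = ≋⇒≈mod (≋-trans (evalPoly-pow j) (≋-sym (pmul-identityˡ (X^ (suc j)))))
binaryExpr-≈ k (suc b) m@(suc (suc _)) j _ log≤ =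
  ≈mod-trans (≋⇒≈mod (evalPoly-withDigit j (two ⊗ e) (m%n<n m 2)))
    (≈mod-trans (≈mod-padd (double-shift k j h e e≈hY) (≋⇒≈mod (≋-refl {pmul (pconst (+ r)) Z})))
      (≋⇒≈mod collect))
  where
  h = m / 2
  r = m % 2
  e = binaryExpr k b h (prev k j)
  Z = X^ (suc j)
  e≈hY : evalPoly e ≈ pmul (pconst (+ h)) (X^ (suc (prev k j))) mod xpowMinus1 (suc k)
  e≈hY = binaryExpr-≈ k b h (prev k j) (m≥n⇒m/n>0 {m} {2} (s≤s (s≤s z≤n)))
           (ℕₚ.≤-pred (ℕₚ.≤-trans (⌈log₂⌉-halve m (s≤s (s≤s z≤n))) log≤))
  collect : padd (pmul (pconst (+ (h + h))) Z) (pmul (pconst (+ r)) Z) ≋ pmul (pconst (+ m)) Z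
  collect = ≋-trans (≋-sym (pmul-distribʳ Z (pconst (+ (h + h))) (pconst (+ r))))
                    (pmul-congʳ Z (∷-≋ (cong +_ (sym (halving m))) (≋-refl {[]})))

-- A bit read at exponent j + 1 costs 2 occurrences for x + x and j + 1 for pow j.
cost : ℕ → ℕ → ℕ → ℕ
cost k zero    j = 0
cost k (suc b) j = 3 + j + cost k b (prev k j)

size-pow≤cost : ∀ k b j → size (pow j) ≤ cost k (suc b) j
size-pow≤cost k b j = ℕₚ.≤-trans (ℕₚ.≤-reflexive (size-pow j))
  (s≤s (ℕₚ.≤-trans (ℕₚ.m≤m+n j _) (ℕₚ.≤-trans (ℕₚ.n≤1+n _) (ℕₚ.n≤1+n _))))

size-binaryExpr : ∀ k b m j → size (binaryExpr k b m j) ≤ cost k (suc b) j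
size-binaryExpr k zero    m                 j = size-pow≤cost k 0 j
size-binaryExpr k (suc b) zero              j = size-pow≤cost k (suc b) j
size-binaryExpr k (suc b) (suc zero)        j = size-pow≤cost k (suc b) j
size-binaryExpr k (suc b) m@(suc (suc _))   j = begin
  size (withDigit (m % 2) j (two ⊗ binaryExpr k b (m / 2) (prev k j)))  ≤⟨ size-withDigit (m % 2) j _ ⟩
  2 + size (binaryExpr k b (m / 2) (prev k j)) + suc j
      ≤⟨ ℕₚ.+-monoˡ-≤ (suc j) (ℕₚ.+-monoʳ-≤ 2 (size-binaryExpr k b (m / 2) (prev k j))) ⟩
  2 + cost k (suc b) (prev k j) + suc j                                 ≡⟨ rearrange (cost k (suc b) (prev k j)) j ⟩
  cost k (suc (suc b)) j                                                ∎
  where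
  open ℕₚ.≤-Reasoning
  rearrange : ∀ c j → 2 + c + suc j ≡ 3 + j + c
  rearrange = ℕ-solve-∀

cost-mono : ∀ k {b b′} j → b ≤ b′ → cost k b j ≤ cost k b′ j
cost-mono k j z≤n       = z≤n
cost-mono k j (s≤s b≤b′) = ℕₚ.+-monoʳ-≤ (3 + j) (cost-mono k (prev k j) b≤b′)

cost-+ : ∀ k j b → cost k (suc j + b) j ≡ cost k (suc j) j + cost k b k
cost-+ k zero    b = refl
cost-+ k (suc j) b = trans (cong (λ n → 3 + suc j + n) (cost-+ k j b)) (sym (ℕₚ.+-assoc (3 + suc j) _ _))

cost-periodic : ∀ k q → cost k (q * suc k) k ≡ q * cost k (suc k) k
cost-periodic k zero    = refl
cost-periodic k (suc q) = trans (cost-+ k k (q * suc k)) (cong (λ n → cost k (suc k) k + n) (cost-periodic k q))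

cost-countdown : ∀ k j → cost k (suc j) j * 2 ≡ suc j * (suc j + 5)
cost-countdown k zero    = refl
cost-countdown k (suc j) = begin
  (3 + suc j + c) * 2                   ≡⟨ expand j c ⟩
  (4 + j) * 2 + c * 2                 ≡⟨ cong (λ n → (4 + j) * 2 + n) (cost-countdown k j) ⟩
  (4 + j) * 2 + suc j * (suc j + 5)   ≡⟨ collect j ⟩
  suc (suc j) * (suc (suc j) + 5)       ∎
  where
  open ≡-Reasoning
  c = cost k (suc j) j
  expand : ∀ j c → (3 + suc j + c) * 2 ≡ (4 + j) * 2 + c * 2
  expand = ℕ-solve-∀
  collect : ∀ j → (4 + j) * 2 + suc j * (suc j + 5) ≡ suc (suc j) * (suc (suc j) + 5)
  collect = ℕ-solve-∀

≤-ceilDiv-* : ∀ a k → a ≤ ceilDiv a (suc k) * suc k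
≤-ceilDiv-* a k = ℕₚ.+-cancelʳ-≤ k a (q * suc k) (begin
  a + k                         ≡⟨ m≡m%n+[m/n]*n (a + k) (suc k) ⟩
  (a + k) % suc k + q * suc k   ≤⟨ ℕₚ.+-monoˡ-≤ (q * suc k) (ℕₚ.≤-pred (m%n<n (a + k) (suc k))) ⟩
  k + q * suc k                 ≡⟨ ℕₚ.+-comm k _ ⟩
  q * suc k + k                 ∎)
  where
  open ℕₚ.≤-Reasoning
  q = ceilDiv a (suc k)

proposition2p4 : (k n : ℕ) → 1 ≤ k → 1 ≤ n →
    Σ Expr (λ e → EvaluatesTo k e (+ n) ×
      size e ≤ ((k * (k + 5)) / 2) * ceilDiv (⌈log₂ n ⌉ + 1) k)
proposition2p4 (suc k) n _ 0<n = e , evaluatesTo-≈ k e (+ n) e≈n , size-bound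
  where
  e = binaryExpr k ⌈log₂ n ⌉ n k
  q = ceilDiv (⌈log₂ n ⌉ + 1) (suc k)
  e≈n : evalPoly e ≈ pconst (+ n) mod xpowMinus1 (suc k)
  e≈n = ≈mod-trans (binaryExpr-≈ k ⌈log₂ n ⌉ n k 0<n ℕₚ.≤-refl) (pconst-X^-period (suc k) (+ n))
  bits≤qk : suc ⌈log₂ n ⌉ ≤ q * suc k
  bits≤qk = subst (_≤ q * suc k) (ℕₚ.+-comm ⌈log₂ n ⌉ 1) (≤-ceilDiv-* (⌈log₂ n ⌉ + 1) k)
  size-bound : size e ≤ ((suc k * (suc k + 5)) / 2) * q
  size-bound = begin
    size e                          ≤⟨ size-binaryExpr k ⌈log₂ n ⌉ n k ⟩
    cost k (suc ⌈log₂ n ⌉) k        ≤⟨ cost-mono k k bits≤qk ⟩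
    cost k (q * suc k) k            ≡⟨ cost-periodic k q ⟩
    q * cost k (suc k) k            ≡⟨ ℕₚ.*-comm q _ ⟩
    cost k (suc k) k * q            ≡⟨ cong (_* q) (sym (m*n/n≡m (cost k (suc k) k) 2)) ⟩
    (cost k (suc k) k * 2) / 2 * q  ≡⟨ cong (λ c → c / 2 * q) (cost-countdown k k) ⟩
    (suc k * (suc k + 5)) / 2 * q   ∎
    where open ℕₚ.≤-Reasoning
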